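{- Let $F$ be a finite field with $q$ elements and let $V$ be a vector space over $F$ of finite dimension $n\ge 1$. Let $L=D-A$ be the Laplacian matrix of the linear dependence graph $\Gamma(V)$, where $A$ is its adjacency matrix and $D$ the diagonal matrix of vertex degrees. Then $$\det(xI-L)=x\,(x-q^n)\,(x-1)^{q^{n-1}+\cdots+q}\,(x-q)^{(q-2)(q^{n-1}+\cdots+q+1)}.$$
   Context: For a finite-dimensional vector space $V$ over a finite field $F$, the linear dependence graph $\Gamma(V)$ is the simple graph whose vertex set is $V$, two vertices $a,b$ being adjacent if and only if $a\neq b$ and $\{a,b\}$ is linearly dependent. The exponent $q^{n-1}+\cdots+q$ denotes $\sum_{i=1}^{n-1}q^i$ (which is $0$ when $n=1$). -}

module Defs where

open import Level using (0ℓ)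
open import Data.Nat using (ℕ; zero; suc) renaming (_+_ to _+ℕ_; _^_ to _^ℕ_)
open import Data.Fin using (Fin; zero; suc; toℕ; punchIn)
open import Data.Vec using (Vec; zipWith; map; replicate)
open import Data.Integer using (ℤ; +_; _-_) renaming (-_ to negℤ; _+_ to _+ℤ_; _*_ to _*ℤ_; _^_ to _^ℤ_)
open import Data.Product using (_×_; ∃)
open import Relation.Binary.PropositionalEquality using (_≡_; _≢_)
open import Relation.Nullary using (¬_; yes; no)
open import Algebra.Structures using (IsCommutativeRing)
open import Function.Bundles using (_↔_; Inverse)
import Data.Fin as Fin

record FiniteField : Set₁ where
  field
    Carrier : Set
    _+_     : Carrier → Carrier → Carrier
    _*_     : Carrier → Carrier → Carrier
    -_      : Carrier → Carrier
    0#      : Carrier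
    1#      : Carrier
    isCommutativeRing : IsCommutativeRing _≡_ _+_ _*_ -_ 0# 1#
    0≢1     : 0# ≢ 1#
    inverse : ∀ x → x ≢ 0# → ∃ λ y → x * y ≡ 1#
    q       : ℕ
    enum    : Fin q ↔ Carrier

-- The vector space F^n (every n-dimensional F-space is isomorphic to it).

module _ (F : FiniteField) where
  open FiniteField F

  V : ℕ → Set
  V n = Vec Carrier n

  zeroV : ∀ {n} → V n
  zeroV = replicate _ 0#

  _⊕_ : ∀ {n} → V n → V n → V n
  _⊕_ = zipWith _+_

  _•_ : ∀ {n} → Carrier → V n → V n
  c • v = map (c *_) v

  LinDep : ∀ {n} → V n → V n → Set
  LinDep a b = ∃ λ λ₁ → ∃ λ λ₂ → ¬ (λ₁ ≡ 0# × λ₂ ≡ 0#) × ((λ₁ • a) ⊕ (λ₂ • b)) ≡ zeroV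

  Adj : ∀ {n} → V n → V n → Set
  Adj a b = a ≢ b × LinDep a b

  IsAdjacencyMatrix : ∀ n {N} → (e : Fin N ↔ V n) → (Fin N → Fin N → ℤ) → Set
  IsAdjacencyMatrix n {N} e A = ∀ i j →
      (Adj (Inverse.to e i) (Inverse.to e j) → A i j ≡ + 1)
    × (¬ Adj (Inverse.to e i) (Inverse.to e j) → A i j ≡ + 0)

Matrix : ℕ → Set
Matrix N = Fin N → Fin N → ℤ

Σ : ∀ {N} → (Fin N → ℤ) → ℤ
Σ {zero}  f = + 0
Σ {suc N} f = f zero +ℤ Σ (λ i → f (suc i))

det : ∀ {N} → Matrix N → ℤ
det {zero}  M = + 1
det {suc N} M = Σ λ j → ((negℤ (+ 1)) ^ℤ toℕ j) *ℤ (M zero j *ℤ det (λ i k → M (suc i) (punchIn j k)))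

δ : ∀ {N} → Fin N → Fin N → ℤ
δ i j with i Fin.≟ j
... | yes _ = + 1
... | no  _ = + 0

degreeMatrix : ∀ {N} → Matrix N → Matrix N
degreeMatrix A i j = δ i j *ℤ Σ (λ k → A i k)

laplacian : ∀ {N} → Matrix N → Matrix N
laplacian A i j = degreeMatrix A i j - A i j

charMatrix : ∀ {N} → ℤ → Matrix N → Matrix N
charMatrix x L i j = (x *ℤ δ i j) - L i j

powSum : ℕ → ℕ → ℕ
powSum q zero    = 0
powSum q (suc m) = powSum q m +ℕ q ^ℕ suc m

-- The origin of Fⁿ is adjacent to every other vector, and the other vectors fall into the
-- L = 1 + q + ⋯ + qⁿ⁻¹ lines through the origin, each a clique on its q - 1 non-zero points; so the
-- origin has degree qⁿ - 1 and every other vertex degree q - 1. Pick on each line the representative ρ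
-- whose first non-zero coordinate is 1. In xI - L, subtracting row ρ from the rows u ≠ ρ of its line
-- leaves (x - q)(eᵤ - e_ρ), which accounts for the factor (x - q)^((q - 2)L); adding these rows back
-- clears their columns elsewhere, and what is left is an arrowhead matrix on the origin and the
-- representatives, of determinant x(x - qⁿ)(x - 1)^(L - 1). That last step divides by x - 1, so x = 1
-- is handled apart: for n ≥ 2 two representative rows coincide, and for n = 1 the matrix is computed.

module Submission where

open import Defs
open import Algebra.Bundles using (AbelianGroup; CommutativeRing)
import Algebra.Properties.CommutativeMonoid.Sum as CommutativeMonoidSum
import Algebra.Properties.Group
import Algebra.Properties.Ring
import Algebra.Properties.Semiring.Sum as SemiringSum
open import Data.Bool using (Bool; true; false; not; _∧_; if_then_else_)
open import Data.Empty using (⊥; ⊥-elim)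
open import Data.Fin using (Fin; zero; suc; toℕ; punchIn)
import Data.Fin as Fin
open import Data.Fin.Permutation using (↔⇒≡)
open import Data.Fin.Properties using (punchInᵢ≢i; suc-injective; toℕ-injective; toℕ-fromℕ<; toℕ<n; inj⇒≟; *↔×)
open import Data.Integer using (ℤ; +_; -_; _+_; _*_; _-_; _^_; 0ℤ; 1ℤ; -1ℤ; +[1+_]; -[1+_])
import Data.Integer as ℤ
import Data.Integer.Properties as ℤ
open import Data.Integer.Tactic.RingSolver using (solve-∀)
open import Data.Nat using (ℕ; zero; suc; _≤_; _∸_; ≢-nonZero) renaming (_^_ to _^ℕ_; _*_ to _*ℕ_; _+_ to _+ℕ_)
import Data.Nat as ℕ
import Data.Nat.Properties as ℕ
open import Data.Product using (_×_; _,_; ∃; proj₁; proj₂)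
open import Data.Product.Function.NonDependent.Propositional using (_×-↔_)
open import Data.Vec using (Vec; []; _∷_)
import Data.Vec.Properties as Vec
open import Function using (_∘_)
open import Function.Bundles using (_↔_; Inverse; mk↔ₛ′)
open import Function.Properties.Inverse using (↔-sym; ↔-trans; ↔⇒↣)
open import Level using (0ℓ)
open import Relation.Binary.PropositionalEquality
open import Relation.Nullary using (¬_; yes; no; Dec; does; ¬?)
open import Relation.Nullary.Decidable using (_×-dec_)

-- Sums and products over Fin N

module ℤSum = SemiringSum ℤ.+-*-semiring
module ℤProduct = CommutativeMonoidSum ℤ.*-1-commutativeMonoid

Σ≡sum : ∀ {N} (f : Fin N → ℤ) → Σ f ≡ ℤSum.sum f
Σ≡sum {zero}  f = refl
Σ≡sum {suc N} f = cong (_+_ (f zero)) (Σ≡sum (f ∘ suc))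

Σ-cong : ∀ {N} {f g : Fin N → ℤ} → (∀ i → f i ≡ g i) → Σ f ≡ Σ g
Σ-cong {zero}  h = refl
Σ-cong {suc N} h = cong₂ _+_ (h zero) (Σ-cong (h ∘ suc))

Σ-distrib-+ : ∀ {N} (f g : Fin N → ℤ) → Σ (λ i → f i + g i) ≡ Σ f + Σ g
Σ-distrib-+ f g = begin
  Σ (λ i → f i + g i)            ≡⟨ Σ≡sum (λ i → f i + g i) ⟩
  ℤSum.sum (λ i → f i + g i)     ≡⟨ ℤSum.∑-distrib-+ f g ⟩
  ℤSum.sum f + ℤSum.sum g        ≡⟨ sym (cong₂ _+_ (Σ≡sum f) (Σ≡sum g)) ⟩
  Σ f + Σ g                      ∎
  where open ≡-Reasoning

Σ-*ˡ : ∀ {N} (c : ℤ) (f : Fin N → ℤ) → Σ (λ i → c * f i) ≡ c * Σ f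
Σ-*ˡ c f = begin
  Σ (λ i → c * f i)          ≡⟨ Σ≡sum (λ i → c * f i) ⟩
  ℤSum.sum (λ i → c * f i)   ≡⟨ sym (ℤSum.*-distribˡ-sum c f) ⟩
  c * ℤSum.sum f             ≡⟨ sym (cong (c *_) (Σ≡sum f)) ⟩
  c * Σ f                    ∎
  where open ≡-Reasoning

Σ-zero : ∀ {N} (f : Fin N → ℤ) → (∀ i → f i ≡ 0ℤ) → Σ f ≡ 0ℤ
Σ-zero {zero}  f h = refl
Σ-zero {suc N} f h rewrite h zero | Σ-zero (f ∘ suc) (h ∘ suc) = refl

Σ-neg : ∀ {N} (f : Fin N → ℤ) → Σ (λ i → - f i) ≡ - Σ f
Σ-neg f = begin
  Σ (λ i → - f i)          ≡⟨ Σ-cong (λ i → sym (ℤ.-1*i≡-i (f i))) ⟩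
  Σ (λ i → -1ℤ * f i)      ≡⟨ Σ-*ˡ -1ℤ f ⟩
  -1ℤ * Σ f                ≡⟨ ℤ.-1*i≡-i (Σ f) ⟩
  - Σ f                    ∎
  where open ≡-Reasoning

Σ-comm : ∀ {M N} (f : Fin M → Fin N → ℤ) → Σ (λ i → Σ (f i)) ≡ Σ (λ j → Σ (λ i → f i j))
Σ-comm f = begin
  Σ (λ i → Σ (f i))                        ≡⟨ trans (Σ≡sum (λ i → Σ (f i))) (ℤSum.sum-cong-≗ (λ i → Σ≡sum (f i))) ⟩
  ℤSum.sum (λ i → ℤSum.sum (f i))          ≡⟨ ℤSum.∑-comm f ⟩
  ℤSum.sum (λ j → ℤSum.sum (λ i → f i j))  ≡⟨ sym (trans (Σ≡sum (λ j → Σ (λ i → f i j)))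
                                                          (ℤSum.sum-cong-≗ (λ j → Σ≡sum (λ i → f i j)))) ⟩
  Σ (λ j → Σ (λ i → f i j))                ∎
  where open ≡-Reasoning

Σ-remove : ∀ {N} (f : Fin (suc N) → ℤ) (j : Fin (suc N)) → Σ f ≡ f j + Σ (f ∘ punchIn j)
Σ-remove f j = begin
  Σ f                               ≡⟨ Σ≡sum f ⟩
  ℤSum.sum f                        ≡⟨ ℤSum.sum-remove f ⟩
  f j + ℤSum.sum (f ∘ punchIn j)    ≡⟨ sym (cong (_+_ (f j)) (Σ≡sum (f ∘ punchIn j))) ⟩
  f j + Σ (f ∘ punchIn j)           ∎
  where open ≡-Reasoning

Σ-const : ∀ N (c : ℤ) → Σ {N} (λ _ → c) ≡ + N * c
Σ-const zero    c = sym (ℤ.*-zeroˡ c)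
Σ-const (suc N) c rewrite Σ-const N c = lem (+ N) c
  where
  lem : ∀ n c → c + n * c ≡ (1ℤ + n) * c
  lem = solve-∀

Π : ∀ {N} → (Fin N → ℤ) → ℤ
Π = ℤProduct.sum

Π-cong : ∀ {N} {f g : Fin N → ℤ} → (∀ i → f i ≡ g i) → Π f ≡ Π g
Π-cong = ℤProduct.sum-cong-≗

Π-remove : ∀ {N} (f : Fin (suc N) → ℤ) (j : Fin (suc N)) → Π f ≡ f j * Π (f ∘ punchIn j)
Π-remove f j = ℤProduct.sum-remove f

Π-distrib-* : ∀ {N} (f g : Fin N → ℤ) → Π (λ i → f i * g i) ≡ Π f * Π g
Π-distrib-* = ℤProduct.∑-distrib-+

Π-ones : ∀ {N} (g : Fin N → ℤ) → (∀ a → g a ≡ 1ℤ) → Π g ≡ 1ℤ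
Π-ones {N} g h = trans (Π-cong h) (ℤProduct.sum-replicate-zero N)

Π-exchange : ∀ {N} (g g′ : Fin N → ℤ) j → (∀ a → a ≢ j → g a ≡ g′ a) → g j * Π g′ ≡ g′ j * Π g
Π-exchange {suc N} g g′ j same rewrite Π-remove g j | Π-remove g′ j
  | Π-cong {f = g′ ∘ punchIn j} {g = g ∘ punchIn j} (λ l → sym (same (punchIn j l) (punchInᵢ≢i j l)))
  = lem (g j) (g′ j) (Π (g ∘ punchIn j))
  where
  lem : ∀ x y z → x * (y * z) ≡ y * (x * z)
  lem = solve-∀

⟦_⟧ : ∀ {P : Set} → Dec P → ℤ
⟦ d ⟧ = if does d then 1ℤ else 0ℤ

⟦⟧-yes : ∀ {P : Set} (d : Dec P) → P → ⟦ d ⟧ ≡ 1ℤ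
⟦⟧-yes (yes _) p = refl
⟦⟧-yes (no ¬p) p = ⊥-elim (¬p p)

⟦⟧-no : ∀ {P : Set} (d : Dec P) → ¬ P → ⟦ d ⟧ ≡ 0ℤ
⟦⟧-no (yes p) ¬p = ⊥-elim (¬p p)
⟦⟧-no (no _)  ¬p = refl

⟦⟧-cong : ∀ {P Q : Set} → (P → Q) → (Q → P) → (d : Dec P) (d′ : Dec Q) → ⟦ d ⟧ ≡ ⟦ d′ ⟧
⟦⟧-cong f g (yes p) d′ = sym (⟦⟧-yes d′ (f p))
⟦⟧-cong f g (no ¬p) d′ = sym (⟦⟧-no d′ (¬p ∘ g))

⟦⟧-sym : ∀ {A : Set} {x y : A} (d : Dec (x ≡ y)) (d′ : Dec (y ≡ x)) → ⟦ d ⟧ ≡ ⟦ d′ ⟧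
⟦⟧-sym = ⟦⟧-cong sym sym

⟦¬⟧ : ∀ {P : Set} (d : Dec P) (d′ : Dec (¬ P)) → ⟦ d′ ⟧ ≡ 1ℤ - ⟦ d ⟧
⟦¬⟧ (yes p) d′ = ⟦⟧-no d′ (λ ¬p → ¬p p)
⟦¬⟧ (no ¬p) d′ = ⟦⟧-yes d′ ¬p

⟦⟧*⟦⟧-no : ∀ {P Q : Set} (d : Dec P) (d′ : Dec Q) → ¬ (P × Q) → ⟦ d ⟧ * ⟦ d′ ⟧ ≡ 0ℤ
⟦⟧*⟦⟧-no (yes p) (yes q) ¬pq = ⊥-elim (¬pq (p , q))
⟦⟧*⟦⟧-no (yes p) (no _)  ¬pq = refl
⟦⟧*⟦⟧-no (no _)  d′      ¬pq = refl

⟦⟧*⟦⟧-yes : ∀ {P Q : Set} (d : Dec P) (d′ : Dec Q) → P → Q → ⟦ d ⟧ * ⟦ d′ ⟧ ≡ 1ℤ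
⟦⟧*⟦⟧-yes d d′ p q rewrite ⟦⟧-yes d p | ⟦⟧-yes d′ q = refl

Σ-delta : ∀ {N} (f : Fin N → ℤ) j → Σ (λ k → ⟦ k Fin.≟ j ⟧ * f k) ≡ f j
Σ-delta {suc N} f j = begin
  Σ (λ k → ⟦ k Fin.≟ j ⟧ * f k)
    ≡⟨ Σ-remove (λ k → ⟦ k Fin.≟ j ⟧ * f k) j ⟩
  ⟦ j Fin.≟ j ⟧ * f j + Σ (λ l → ⟦ punchIn j l Fin.≟ j ⟧ * f (punchIn j l))
    ≡⟨ cong₂ _+_ (cong (_* f j) (⟦⟧-yes (j Fin.≟ j) refl)) (Σ-zero _ off-diagonal) ⟩
  1ℤ * f j + 0ℤ
    ≡⟨ ℤ.+-identityʳ _ ⟩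
  1ℤ * f j
    ≡⟨ ℤ.*-identityˡ (f j) ⟩
  f j ∎
  where
  open ≡-Reasoning
  off-diagonal : ∀ l → ⟦ punchIn j l Fin.≟ j ⟧ * f (punchIn j l) ≡ 0ℤ
  off-diagonal l = cong (_* f (punchIn j l)) (⟦⟧-no (punchIn j l Fin.≟ j) (punchInᵢ≢i j l))

Σ-unique : ∀ {N} (f : Fin N → ℤ) j v → (∀ k → f k ≡ ⟦ k Fin.≟ j ⟧ * v) → Σ f ≡ v
Σ-unique f j v h = trans (Σ-cong h) (Σ-delta (λ _ → v) j)

count : ∀ {N} → (Fin N → Bool) → ℕ
count {zero}  P = 0
count {suc N} P = (if P zero then 1 else 0) ℕ.+ count (P ∘ suc)

Σ-count : ∀ {N} (P : Fin N → Bool) → Σ (λ k → if P k then 1ℤ else 0ℤ) ≡ + count P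
Σ-count {zero}  P = refl
Σ-count {suc N} P with P zero
... | true  = cong (_+_ 1ℤ) (Σ-count (P ∘ suc))
... | false = trans (ℤ.+-identityˡ _) (Σ-count (P ∘ suc))

Π-count : ∀ {N} (P : Fin N → Bool) a → Π (λ k → if P k then a else 1ℤ) ≡ a ^ count P
Π-count {zero}  P a = refl
Π-count {suc N} P a with P zero
... | true  = cong (a *_) (Π-count (P ∘ suc) a)
... | false = trans (ℤ.*-identityˡ _) (Π-count (P ∘ suc) a)

Σ-¬ : ∀ {N} {P : Fin N → Set} (d : ∀ k → Dec (P k)) → Σ (λ k → ⟦ ¬? (d k) ⟧) ≡ + N - Σ (λ k → ⟦ d k ⟧)
Σ-¬ {N} d = begin
  Σ (λ k → ⟦ ¬? (d k) ⟧)                 ≡⟨ Σ-cong (λ k → ⟦¬⟧ (d k) (¬? (d k))) ⟩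
  Σ (λ k → 1ℤ - ⟦ d k ⟧)                 ≡⟨ Σ-distrib-+ (λ _ → 1ℤ) (λ k → - ⟦ d k ⟧) ⟩
  Σ {N} (λ _ → 1ℤ) + Σ (λ k → - ⟦ d k ⟧) ≡⟨ cong₂ _+_ (trans (Σ-const N 1ℤ) (ℤ.*-identityʳ (+ N))) (Σ-neg (λ k → ⟦ d k ⟧)) ⟩
  + N - Σ (λ k → ⟦ d k ⟧)                ∎
  where open ≡-Reasoning

Σ-pairs : ∀ {N} (h : Fin (suc N) → Fin (suc N) → ℤ) →
          Σ (λ a → Σ (λ l → h a (punchIn a l))) ≡ Σ (λ b → Σ (λ l → h (punchIn b l) b))
Σ-pairs h = begin
  Σ (λ a → Σ (λ l → h a (punchIn a l)))    ≡⟨ Σ-cong (λ a → drop-diagonal (h a) a) ⟩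
  Σ (λ a → Σ (h a) - h a a)                ≡⟨ Σ-distrib-+ (λ a → Σ (h a)) (λ a → - h a a) ⟩
  Σ (λ a → Σ (h a)) + Σ (λ a → - h a a)    ≡⟨ cong (_+ Σ (λ a → - h a a)) (Σ-comm h) ⟩
  Σ (λ b → Σ (λ a → h a b)) + Σ (λ a → - h a a)
                                           ≡⟨ sym (Σ-distrib-+ (λ b → Σ (λ a → h a b)) (λ a → - h a a)) ⟩
  Σ (λ b → Σ (λ a → h a b) - h b b)        ≡⟨ sym (Σ-cong (λ b → drop-diagonal (λ a → h a b) b)) ⟩
  Σ (λ b → Σ (λ l → h (punchIn b l) b))    ∎
  where
  open ≡-Reasoning
  drop-diagonal : ∀ {N} (f : Fin (suc N) → ℤ) j → Σ (f ∘ punchIn j) ≡ Σ f - f j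
  drop-diagonal f j rewrite Σ-remove f j = lem (f j) (Σ (f ∘ punchIn j))
    where
    lem : ∀ a s → s ≡ (a + s) - a
    lem = solve-∀

x≡-x⇒x≡0 : ∀ (x : ℤ) → x ≡ - x → x ≡ 0ℤ
x≡-x⇒x≡0 (+ zero)  _ = refl
x≡-x⇒x≡0 +[1+ n ] ()
x≡-x⇒x≡0 -[1+ n ] ()

-- Determinants

sign : ∀ {N} → Fin N → ℤ
sign j = -1ℤ ^ toℕ j

minor : ∀ {N} → Matrix (suc N) → Fin (suc N) → Matrix N
minor M j a k = M (suc a) (punchIn j k)

det-cong : ∀ {N} (M M′ : Matrix N) → (∀ a b → M a b ≡ M′ a b) → det M ≡ det M′
det-cong {zero}  M M′ h = refl
det-cong {suc N} M M′ h = Σ-cong λ j → cong₂ (λ u v → sign j * (u * v)) (h zero j)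
  (det-cong (minor M j) (minor M′ j) (λ a k → h (suc a) (punchIn j k)))

RowsAgreeExcept : ∀ {N} → Fin N → Matrix N → Matrix N → Set
RowsAgreeExcept i M M′ = ∀ a b → a ≢ i → M′ a b ≡ M a b

det-linear : ∀ {N} (i : Fin N) (s : ℤ) (M M′ M″ : Matrix N) →
             RowsAgreeExcept i M M″ → RowsAgreeExcept i M M′ →
             (∀ b → M″ i b ≡ s * M i b + M′ i b) → det M″ ≡ s * det M + det M′
det-linear {suc N} i s M M′ M″ M″≈M M′≈M row-i = begin
  Σ (term M″)                                ≡⟨ Σ-cong (term-linear i M″≈M M′≈M row-i) ⟩
  Σ (λ j → s * term M j + term M′ j)         ≡⟨ Σ-distrib-+ (λ j → s * term M j) (term M′) ⟩
  Σ (λ j → s * term M j) + Σ (term M′)       ≡⟨ cong (_+ Σ (term M′)) (Σ-*ˡ s (term M)) ⟩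
  s * Σ (term M) + Σ (term M′)               ∎
  where
  open ≡-Reasoning
  term : Matrix (suc N) → Fin (suc N) → ℤ
  term X j = sign j * (X zero j * det (minor X j))
  term-linear : ∀ i → RowsAgreeExcept i M M″ → RowsAgreeExcept i M M′ → (∀ b → M″ i b ≡ s * M i b + M′ i b) →
                ∀ j → term M″ j ≡ s * term M j + term M′ j
  term-linear zero M″≈M M′≈M row-0 j
    rewrite row-0 j
          | det-cong (minor M″ j) (minor M j) (λ a k → M″≈M (suc a) (punchIn j k) λ ())
          | det-cong (minor M′ j) (minor M j) (λ a k → M′≈M (suc a) (punchIn j k) λ ())
          = lem s (sign j) (M zero j) (M′ zero j) (det (minor M j))
    where
    lem : ∀ s g a b d → g * ((s * a + b) * d) ≡ s * (g * (a * d)) + g * (b * d)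
    lem = solve-∀
  term-linear (suc i) M″≈M M′≈M row-i j
    rewrite M″≈M zero j (λ ()) | M′≈M zero j (λ ())
          | det-linear i s (minor M j) (minor M′ j) (minor M″ j)
              (λ a b a≢i → M″≈M (suc a) (punchIn j b) (a≢i ∘ suc-injective))
              (λ a b a≢i → M′≈M (suc a) (punchIn j b) (a≢i ∘ suc-injective))
              (λ b → row-i (punchIn j b))
          = lem s (sign j) (M zero j) (det (minor M j)) (det (minor M′ j))
    where
    lem : ∀ s g m d d′ → g * (m * (s * d + d′)) ≡ s * (g * (m * d)) + g * (m * d′)
    lem = solve-∀

det-additive : ∀ {N} (i : Fin N) (M M′ M″ : Matrix N) →
               RowsAgreeExcept i M M″ → RowsAgreeExcept i M M′ →
               (∀ b → M″ i b ≡ M i b + M′ i b) → det M″ ≡ det M + det M′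
det-additive i M M′ M″ M″≈M M′≈M row-i =
  trans (det-linear i 1ℤ M M′ M″ M″≈M M′≈M (λ b → trans (row-i b) (cong (_+ M′ i b) (sym (ℤ.*-identityˡ (M i b))))))
        (cong (_+ det M′) (ℤ.*-identityˡ (det M)))

-- `punchOut₀ a b` is the position of b among the indices other than a (junk when a = b).
punchOut₀ : ∀ {n} → Fin (suc (suc n)) → Fin (suc (suc n)) → Fin (suc n)
punchOut₀ zero    zero    = zero
punchOut₀ zero    (suc b) = b
punchOut₀ (suc a) zero    = zero
punchOut₀ {suc n} (suc a) (suc b) = suc (punchOut₀ a b)
punchOut₀ {zero}  (suc a) (suc b) = zero

punchOut₀-punchIn : ∀ {n} (j : Fin (suc (suc n))) (l : Fin (suc n)) → punchOut₀ j (punchIn j l) ≡ l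
punchOut₀-punchIn zero    l       = refl
punchOut₀-punchIn (suc j) zero    = refl
punchOut₀-punchIn {suc n} (suc j) (suc l) = cong suc (punchOut₀-punchIn j l)

punchIn-punchOut₀-comm : ∀ {n} (a b : Fin (suc (suc n))) → a ≢ b → (m : Fin n) →
                         punchIn a (punchIn (punchOut₀ a b) m) ≡ punchIn b (punchIn (punchOut₀ b a) m)
punchIn-punchOut₀-comm zero    zero    a≢b m = ⊥-elim (a≢b refl)
punchIn-punchOut₀-comm zero    (suc b) a≢b m = refl
punchIn-punchOut₀-comm (suc a) zero    a≢b m = refl
punchIn-punchOut₀-comm {suc n} (suc a) (suc b) a≢b zero    = refl
punchIn-punchOut₀-comm {suc n} (suc a) (suc b) a≢b (suc m) = cong suc (punchIn-punchOut₀-comm a b (a≢b ∘ cong suc) m)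

sign-punchOut₀ : ∀ {n} (a b : Fin (suc (suc n))) → a ≢ b →
                 sign a * sign (punchOut₀ a b) ≡ - (sign b * sign (punchOut₀ b a))
sign-punchOut₀ zero    zero    a≢b = ⊥-elim (a≢b refl)
sign-punchOut₀ zero    (suc b) a≢b = lem (sign b)
  where
  lem : ∀ x → 1ℤ * x ≡ - ((-1ℤ * x) * 1ℤ)
  lem = solve-∀
sign-punchOut₀ (suc a) zero    a≢b = lem (sign a)
  where
  lem : ∀ x → (-1ℤ * x) * 1ℤ ≡ - (1ℤ * x)
  lem = solve-∀
sign-punchOut₀ {suc n} (suc a) (suc b) a≢b =
  trans (lem (sign a) (sign (punchOut₀ a b)))
        (trans (sign-punchOut₀ a b (a≢b ∘ cong suc)) (cong -_ (sym (lem (sign b) (sign (punchOut₀ b a))))))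
  where
  lem : ∀ x y → (-1ℤ * x) * (-1ℤ * y) ≡ x * y
  lem = solve-∀
sign-punchOut₀ {zero} (suc zero) (suc zero) a≢b = ⊥-elim (a≢b refl)

-- Expanding along the first two rows, the terms for the column pairs (a , b) and (b , a) cancel.
det-equal-first-rows : ∀ {N} (M : Matrix (suc (suc N))) → (∀ b → M zero b ≡ M (suc zero) b) → det M ≡ 0ℤ
det-equal-first-rows {N} M row₀≡row₁ =
  x≡-x⇒x≡0 (det M) (begin
    det M                                              ≡⟨ expand ⟩
    Σ (λ a → Σ (λ l → h a (punchIn a l)))              ≡⟨ Σ-pairs h ⟩
    Σ (λ b → Σ (λ l → h (punchIn b l) b))              ≡⟨ Σ-cong (λ b → Σ-cong (λ l → antisymmetric (punchIn b l) b (punchInᵢ≢i b l))) ⟩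
    Σ (λ b → Σ (λ l → - h b (punchIn b l)))            ≡⟨ Σ-cong (λ b → Σ-neg (λ l → h b (punchIn b l))) ⟩
    Σ (λ b → - Σ (λ l → h b (punchIn b l)))            ≡⟨ Σ-neg (λ b → Σ (λ l → h b (punchIn b l))) ⟩
    - Σ (λ a → Σ (λ l → h a (punchIn a l)))            ≡⟨ cong -_ (sym expand) ⟩
    - det M                                            ∎)
  where
  open ≡-Reasoning
  r : Fin (suc (suc N)) → ℤ
  r = M zero
  D : Fin (suc (suc N)) → Fin (suc (suc N)) → ℤ
  D a b = det (λ c m → M (suc (suc c)) (punchIn a (punchIn (punchOut₀ a b) m)))
  h : Fin (suc (suc N)) → Fin (suc (suc N)) → ℤ
  h a b = (sign a * sign (punchOut₀ a b)) * ((r a * r b) * D a b)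
  second-row : ∀ a → Fin (suc N) → ℤ
  second-row a l = sign l * (M (suc zero) (punchIn a l) * det (λ c m → M (suc (suc c)) (punchIn a (punchIn l m))))
  expand-term : ∀ a l → sign a * (r a * second-row a l) ≡ h a (punchIn a l)
  expand-term a l = begin
    sign a * (r a * second-row a l)
      ≡⟨ cong₂ (λ u v → sign a * (r a * (sign l * (u * v)))) (sym (row₀≡row₁ (punchIn a l)))
               (det-cong _ _ (λ c m → cong (λ t → M (suc (suc c)) (punchIn a (punchIn t m))) (sym (punchOut₀-punchIn a l)))) ⟩
    sign a * (r a * (sign l * (r (punchIn a l) * D a (punchIn a l))))
      ≡⟨ lem (sign a) (r a) (sign l) (r (punchIn a l)) (D a (punchIn a l)) ⟩
    (sign a * sign l) * ((r a * r (punchIn a l)) * D a (punchIn a l))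
      ≡⟨ cong (λ t → (sign a * sign t) * ((r a * r (punchIn a l)) * D a (punchIn a l))) (sym (punchOut₀-punchIn a l)) ⟩
    h a (punchIn a l) ∎
    where
    lem : ∀ g x y z w → g * (x * (y * (z * w))) ≡ (g * y) * ((x * z) * w)
    lem = solve-∀
  expand : det M ≡ Σ (λ a → Σ (λ l → h a (punchIn a l)))
  expand = Σ-cong λ a → begin
    sign a * (r a * Σ (second-row a))        ≡⟨ cong (sign a *_) (sym (Σ-*ˡ (r a) (second-row a))) ⟩
    sign a * Σ (λ l → r a * second-row a l)  ≡⟨ sym (Σ-*ˡ (sign a) (λ l → r a * second-row a l)) ⟩
    Σ (λ l → sign a * (r a * second-row a l)) ≡⟨ Σ-cong (expand-term a) ⟩
    Σ (λ l → h a (punchIn a l))              ∎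
  antisymmetric : ∀ a b → a ≢ b → h a b ≡ - h b a
  antisymmetric a b a≢b
    rewrite sign-punchOut₀ a b a≢b
          | det-cong (λ c m → M (suc (suc c)) (punchIn a (punchIn (punchOut₀ a b) m)))
                     (λ c m → M (suc (suc c)) (punchIn b (punchIn (punchOut₀ b a) m)))
                     (λ c m → cong (M (suc (suc c))) (punchIn-punchOut₀-comm a b a≢b m))
          = lem (sign b * sign (punchOut₀ b a)) (r a) (r b) (D b a)
    where
    lem : ∀ s x y d → (- s) * ((x * y) * d) ≡ - (s * ((y * x) * d))
    lem = solve-∀

replaceRow : ∀ {N} → Matrix N → Fin N → (Fin N → ℤ) → Matrix N
replaceRow M i r a b with a Fin.≟ i
... | yes _ = r b
... | no  _ = M a b

replaceRow-≡ : ∀ {N} (M : Matrix N) i r b → replaceRow M i r i b ≡ r b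
replaceRow-≡ M i r b with i Fin.≟ i
... | yes _   = refl
... | no  i≢i = ⊥-elim (i≢i refl)

replaceRow-≢ : ∀ {N} (M : Matrix N) i r → RowsAgreeExcept i M (replaceRow M i r)
replaceRow-≢ M i r a b a≢i with a Fin.≟ i
... | yes a≡i = ⊥-elim (a≢i a≡i)
... | no  _   = refl

replaceRow-agree : ∀ {N} (M : Matrix N) i r r′ → RowsAgreeExcept i (replaceRow M i r) (replaceRow M i r′)
replaceRow-agree M i r r′ a b a≢i = trans (replaceRow-≢ M i r′ a b a≢i) (sym (replaceRow-≢ M i r a b a≢i))

replaceRow-additive : ∀ {N} (M : Matrix N) i (r r′ : Fin N → ℤ) →
                      det (replaceRow M i (λ b → r b + r′ b)) ≡ det (replaceRow M i r) + det (replaceRow M i r′)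
replaceRow-additive M i r r′ =
  det-additive i (replaceRow M i r) (replaceRow M i r′) (replaceRow M i (λ b → r b + r′ b))
    (replaceRow-agree M i r _) (replaceRow-agree M i r r′)
    (λ b → trans (replaceRow-≡ M i _ b) (sym (cong₂ _+_ (replaceRow-≡ M i r b) (replaceRow-≡ M i r′ b))))

Alternating : ℕ → Set
Alternating N = ∀ (M : Matrix N) i k → i ≢ k → (∀ b → M i b ≡ M k b) → det M ≡ 0ℤ

-- Expanding 0 = det (rows i and k both equal to rᵢ + rₖ) by additivity in both rows.
det-swap : ∀ {N} → Alternating N → ∀ (M M′ : Matrix N) i k → i ≢ k →
           (∀ b → M′ i b ≡ M k b) → (∀ b → M′ k b ≡ M i b) →
           (∀ a b → a ≢ i → a ≢ k → M′ a b ≡ M a b) → det M′ ≡ - det M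
det-swap {N} alternating M M′ i k i≢k row-i row-k others = inverseʳ-unique (det M) (det M′) (begin
  det M + det M′
    ≡⟨ cong₂ _+_ (sym (twice-≗ {M i} {M k} M (λ _ → refl) (λ _ → refl) (λ _ _ _ _ → refl))) (sym (twice-≗ M′ row-i row-k others)) ⟩
  det (twice (M i) (M k)) + det (twice (M k) (M i))
    ≡⟨ lem (det (twice (M i) (M i))) _ _ (det (twice (M k) (M k))) (diagonal (M i)) (diagonal (M k)) ⟩
  (det (twice (M i) (M i)) + det (twice (M i) (M k))) + (det (twice (M k) (M i)) + det (twice (M k) (M k)))
    ≡⟨ sym (cong₂ _+_ (additiveʳ (M i) (M i) (M k)) (additiveʳ (M k) (M i) (M k))) ⟩
  det (twice (M i) sum) + det (twice (M k) sum)
    ≡⟨ sym (replaceRow-additive (replaceRow M k sum) i (M i) (M k)) ⟩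
  det (twice sum sum)
    ≡⟨ diagonal sum ⟩
  0ℤ ∎)
  where
  open ≡-Reasoning
  open Algebra.Properties.Group (AbelianGroup.group ℤ.+-0-abelianGroup) using (inverseʳ-unique)
  twice : (Fin N → ℤ) → (Fin N → ℤ) → Matrix N
  twice u v = replaceRow (replaceRow M k v) i u
  at-k : ∀ u v b → twice u v k b ≡ v b
  at-k u v b = trans (replaceRow-≢ (replaceRow M k v) i u k b (i≢k ∘ sym)) (replaceRow-≡ M k v b)
  sum : Fin N → ℤ
  sum b = M i b + M k b
  diagonal : ∀ u → det (twice u u) ≡ 0ℤ
  diagonal u = alternating (twice u u) i k i≢k (λ b → trans (replaceRow-≡ _ i u b) (sym (at-k u u b)))
  off-k : ∀ u v v′ → RowsAgreeExcept k (twice u v) (twice u v′)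
  off-k u v v′ a b a≢k with a Fin.≟ i
  ... | yes _ = refl
  ... | no  _ = trans (replaceRow-≢ M k v′ a b a≢k) (sym (replaceRow-≢ M k v a b a≢k))
  additiveʳ : ∀ u v v′ → det (twice u (λ b → v b + v′ b)) ≡ det (twice u v) + det (twice u v′)
  additiveʳ u v v′ = det-additive k (twice u v) (twice u v′) (twice u (λ b → v b + v′ b))
    (off-k u v _) (off-k u v v′) (λ b → trans (at-k u _ b) (sym (cong₂ _+_ (at-k u v b) (at-k u v′ b))))
  twice-≗ : ∀ {u v} (X : Matrix N) → (∀ b → X i b ≡ u b) → (∀ b → X k b ≡ v b) →
            (∀ a b → a ≢ i → a ≢ k → X a b ≡ M a b) → det (twice u v) ≡ det X
  twice-≗ {u} {v} X X-i X-k X-others = det-cong (twice u v) X entry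
    where
    entry : ∀ a b → twice u v a b ≡ X a b
    entry a b with a Fin.≟ i
    ... | yes refl = sym (X-i b)
    ... | no  a≢i with a Fin.≟ k
    ...   | yes refl = sym (X-k b)
    ...   | no  a≢k  = sym (X-others a b a≢i a≢k)
  lem : ∀ a b c d → a ≡ 0ℤ → d ≡ 0ℤ → b + c ≡ (a + b) + (c + d)
  lem a b c d refl refl = sym (cong₂ _+_ (ℤ.+-identityˡ b) (ℤ.+-identityʳ c))

-- Swapping rows 1 and k + 1 reduces to equal rows 0 and 1, at the price of a sign.
det-first-row-repeated : ∀ N → Alternating N → (M : Matrix (suc N)) (k : Fin N) →
                         (∀ b → M zero b ≡ M (suc k) b) → det M ≡ 0ℤ
det-first-row-repeated (suc N) alternating M zero    row₀≡row₁ = det-equal-first-rows M row₀≡row₁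
det-first-row-repeated (suc N) alternating M (suc k) row₀≡rowₖ =
  neg-zero (trans (sym det-M′) (det-equal-first-rows M′ rows₀₁))
  where
  one other : Fin (suc (suc N))
  one   = suc zero
  other = suc (suc k)
  one≢other : one ≢ other
  one≢other ()
  M′ : Matrix (suc (suc N))
  M′ = replaceRow (replaceRow M other (M one)) one (M other)
  at-one : ∀ b → M′ one b ≡ M other b
  at-one = replaceRow-≡ (replaceRow M other (M one)) one (M other)
  at-other : ∀ b → M′ other b ≡ M one b
  at-other b = trans (replaceRow-≢ (replaceRow M other (M one)) one (M other) other b (one≢other ∘ sym)) (replaceRow-≡ M other (M one) b)
  elsewhere : ∀ a b → a ≢ one → a ≢ other → M′ a b ≡ M a b
  elsewhere a b a≢one a≢other =
    trans (replaceRow-≢ (replaceRow M other (M one)) one (M other) a b a≢one) (replaceRow-≢ M other (M one) a b a≢other)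
  rows₀₁ : ∀ b → M′ zero b ≡ M′ one b
  rows₀₁ b = trans (elsewhere zero b (λ ()) (λ ())) (trans (row₀≡rowₖ b) (sym (at-one b)))
  det-M′ : det M′ ≡ - det M
  det-M′ = trans (Σ-cong term) (Σ-neg (λ j → sign j * (M zero j * det (minor M j))))
    where
    term : ∀ j → sign j * (M′ zero j * det (minor M′ j)) ≡ - (sign j * (M zero j * det (minor M j)))
    term j
      rewrite elsewhere zero j (λ ()) (λ ())
            | det-swap alternating (minor M j) (minor M′ j) zero (suc k) (λ ())
                (λ b → at-one (punchIn j b)) (λ b → at-other (punchIn j b))
                (λ a b a≢0 a≢k → elsewhere (suc a) (punchIn j b) (a≢0 ∘ suc-injective) (a≢k ∘ suc-injective))
            = sym (trans (ℤ.neg-distribʳ-* (sign j) _) (cong (sign j *_) (ℤ.neg-distribʳ-* (M zero j) _)))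
  neg-zero : ∀ {x} → - x ≡ 0ℤ → x ≡ 0ℤ
  neg-zero {x} -x≡0 = trans (sym (ℤ.neg-involutive x)) (cong -_ -x≡0)

det-alternating : ∀ N → Alternating N
det-alternating (suc N) M zero    zero    0≢0 _ = ⊥-elim (0≢0 refl)
det-alternating (suc N) M zero    (suc k) _   eq = det-first-row-repeated N (det-alternating N) M k eq
det-alternating (suc N) M (suc i) zero    _   eq = det-first-row-repeated N (det-alternating N) M i (sym ∘ eq)
det-alternating (suc N) M (suc i) (suc k) i≢k eq = Σ-zero _ λ j →
  trans (cong (λ t → sign j * (M zero j * t))
              (det-alternating N (minor M j) i k (i≢k ∘ cong suc) (eq ∘ punchIn j)))
        (trans (cong (sign j *_) (ℤ.*-zeroʳ (M zero j))) (ℤ.*-zeroʳ (sign j)))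

-- Row operations

det-zeroRow : ∀ {N} (M : Matrix N) i → (∀ b → M i b ≡ 0ℤ) → det M ≡ 0ℤ
det-zeroRow {suc N} M zero    row-i = Σ-zero _ λ j →
  trans (cong (λ t → sign j * (t * det (minor M j))) (row-i j)) (ℤ.*-zeroʳ (sign j))
det-zeroRow {suc N} M (suc i) row-i = Σ-zero _ λ j →
  trans (cong (λ t → sign j * (M zero j * t)) (det-zeroRow (minor M j) i (row-i ∘ punchIn j)))
        (trans (cong (sign j *_) (ℤ.*-zeroʳ (M zero j))) (ℤ.*-zeroʳ (sign j)))

det-scaleRow : ∀ {N} (M M′ : Matrix N) i s → RowsAgreeExcept i M M′ → (∀ b → M′ i b ≡ s * M i b) →
               det M′ ≡ s * det M
det-scaleRow M M′ i s M′≈M row-i = begin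
  det M′                  ≡⟨ det-linear i s M Z M′ M′≈M (replaceRow-≢ M i _) row-i′ ⟩
  s * det M + det Z       ≡⟨ cong (_+_ (s * det M)) (det-zeroRow Z i (replaceRow-≡ M i _)) ⟩
  s * det M + 0ℤ          ≡⟨ ℤ.+-identityʳ _ ⟩
  s * det M               ∎
  where
  open ≡-Reasoning
  Z = replaceRow M i (λ _ → 0ℤ)
  row-i′ : ∀ b → M′ i b ≡ s * M i b + Z i b
  row-i′ b = trans (row-i b) (sym (trans (cong (_+_ (s * M i b)) (replaceRow-≡ M i _ b)) (ℤ.+-identityʳ _)))

det-proportionalRows : ∀ {N} (M : Matrix N) i k c → i ≢ k → (∀ b → M k b ≡ c * M i b) → det M ≡ 0ℤ
det-proportionalRows M i k c i≢k row-k = begin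
  det M          ≡⟨ det-scaleRow W M k c (λ a b a≢k → sym (replaceRow-≢ M k _ a b a≢k)) row-k′ ⟩
  c * det W      ≡⟨ cong (c *_) (det-alternating _ W i k i≢k equal) ⟩
  c * 0ℤ         ≡⟨ ℤ.*-zeroʳ c ⟩
  0ℤ             ∎
  where
  open ≡-Reasoning
  W = replaceRow M k (M i)
  row-k′ : ∀ b → M k b ≡ c * W k b
  row-k′ b = trans (row-k b) (cong (c *_) (sym (replaceRow-≡ M k (M i) b)))
  equal : ∀ b → W i b ≡ W k b
  equal b = trans (replaceRow-≢ M k _ i b i≢k) (sym (replaceRow-≡ M k (M i) b))

data Dependent {N} (Allowed : Fin N → Set) (M : Matrix N) (w : Fin N → ℤ) : Set where
  zero-vector     : (∀ b → w b ≡ 0ℤ) → Dependent Allowed M w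
  multiple-of-row : (k : Fin N) (c : ℤ) → Allowed k → (∀ b → w b ≡ c * M k b) → Dependent Allowed M w
  row-multiple-of : (k : Fin N) (c : ℤ) → Allowed k → (∀ b → M k b ≡ c * w b) → Dependent Allowed M w

Dependent-transfer : ∀ {N} {A A′ : Fin N → Set} {M M′ : Matrix N} {w} →
                     (∀ {k} → A k → A′ k) → (∀ k b → A k → M k b ≡ M′ k b) →
                     Dependent A M w → Dependent A′ M′ w
Dependent-transfer A⇒A′ M≈M′ (zero-vector w≡0) = zero-vector w≡0
Dependent-transfer A⇒A′ M≈M′ (multiple-of-row k c ok w≡cMk) =
  multiple-of-row k c (A⇒A′ ok) (λ b → trans (w≡cMk b) (cong (c *_) (M≈M′ k b ok)))
Dependent-transfer A⇒A′ M≈M′ (row-multiple-of k c ok Mk≡cw) =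
  row-multiple-of k c (A⇒A′ ok) (λ b → trans (sym (M≈M′ k b ok)) (Mk≡cw b))

det-replace-dependent : ∀ {N} (M : Matrix N) i w → Dependent (_≢ i) M w → det (replaceRow M i w) ≡ 0ℤ
det-replace-dependent M i w (zero-vector w≡0) = det-zeroRow _ i (λ b → trans (replaceRow-≡ M i w b) (w≡0 b))
det-replace-dependent M i w (multiple-of-row k c k≢i w≡cMk) =
  det-proportionalRows _ k i c k≢i (λ b → trans (replaceRow-≡ M i w b)
    (trans (w≡cMk b) (cong (c *_) (sym (replaceRow-≢ M i w k b k≢i)))))
det-replace-dependent M i w (row-multiple-of k c k≢i Mk≡cw) =
  det-proportionalRows _ i k c (k≢i ∘ sym) (λ b → trans (replaceRow-≢ M i w k b k≢i)
    (trans (Mk≡cw b) (cong (c *_) (sym (replaceRow-≡ M i w b)))))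

det-add-dependent : ∀ {N} (M M′ : Matrix N) i w → Dependent (_≢ i) M w → RowsAgreeExcept i M M′ →
                    (∀ b → M′ i b ≡ M i b + w b) → det M′ ≡ det M
det-add-dependent M M′ i w dep M′≈M row-i = begin
  det M′                            ≡⟨ det-additive i M (replaceRow M i w) M′ M′≈M (replaceRow-≢ M i w) row-i′ ⟩
  det M + det (replaceRow M i w)    ≡⟨ cong (_+_ (det M)) (det-replace-dependent M i w dep) ⟩
  det M + 0ℤ                        ≡⟨ ℤ.+-identityʳ _ ⟩
  det M                             ∎
  where
  open ≡-Reasoning
  row-i′ : ∀ b → M′ i b ≡ M i b + replaceRow M i w i b
  row-i′ b = trans (row-i b) (cong (_+_ (M i b)) (sym (replaceRow-≡ M i w b)))

det-add-Σ : ∀ {N} T (M M′ : Matrix N) i (W : Fin T → Fin N → ℤ) → (∀ t → Dependent (_≢ i) M (W t)) →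
            RowsAgreeExcept i M M′ → (∀ b → M′ i b ≡ M i b + Σ (λ t → W t b)) → det M′ ≡ det M
det-add-Σ zero M M′ i W dep M′≈M row-i =
  det-add-dependent M M′ i (λ _ → 0ℤ) (zero-vector (λ _ → refl)) M′≈M row-i
det-add-Σ (suc T) M M′ i W dep M′≈M row-i = begin
  det M′    ≡⟨ det-add-dependent K M′ i (W zero) dep₀ M′≈K row-i′ ⟩
  det K     ≡⟨ det-add-Σ T M K i (W ∘ suc) (dep ∘ suc) (replaceRow-≢ M i _) (replaceRow-≡ M i _) ⟩
  det M     ∎
  where
  open ≡-Reasoning
  K = replaceRow M i (λ b → M i b + Σ (λ t → W (suc t) b))
  M′≈K : RowsAgreeExcept i K M′
  M′≈K a b a≢i = trans (M′≈M a b a≢i) (sym (replaceRow-≢ M i _ a b a≢i))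
  dep₀ : Dependent (_≢ i) K (W zero)
  dep₀ = Dependent-transfer (λ k≢i → k≢i) (λ k b k≢i → sym (replaceRow-≢ M i _ k b k≢i)) (dep zero)
  row-i′ : ∀ b → M′ i b ≡ K i b + W zero b
  row-i′ b = trans (row-i b) (trans (lem (M i b) (W zero b) (Σ (λ t → W (suc t) b)))
                                    (cong (_+ W zero b) (sym (replaceRow-≡ M i _ b))))
    where
    lem : ∀ x y z → x + (y + z) ≡ (x + z) + y
    lem = solve-∀

det-diagonal : ∀ {N} (D : Matrix N) → (∀ a b → a ≢ b → D a b ≡ 0ℤ) → det D ≡ Π (λ a → D a a)
det-diagonal {zero}  D off = refl
det-diagonal {suc N} D off = begin
  sign {suc N} zero * (D zero zero * det (minor D zero)) + Σ (λ j → sign (suc j) * (D zero (suc j) * det (minor D (suc j))))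
    ≡⟨ cong₂ _+_ (cong (λ t → 1ℤ * (D zero zero * t)) (det-diagonal (minor D zero) off′)) (Σ-zero _ off-row) ⟩
  1ℤ * (D zero zero * Π (λ a → D (suc a) (suc a))) + 0ℤ
    ≡⟨ trans (ℤ.+-identityʳ _) (ℤ.*-identityˡ _) ⟩
  D zero zero * Π (λ a → D (suc a) (suc a)) ∎
  where
  open ≡-Reasoning
  off′ : ∀ a b → a ≢ b → minor D zero a b ≡ 0ℤ
  off′ a b a≢b = off (suc a) (suc b) (a≢b ∘ suc-injective)
  off-row : ∀ j → sign (suc j) * (D zero (suc j) * det (minor D (suc j))) ≡ 0ℤ
  off-row j rewrite off zero (suc j) (λ ()) = ℤ.*-zeroʳ (sign (suc j))

<ᵇ-suc : ∀ m t → m ≢ t → (m ℕ.<ᵇ suc t) ≡ (m ℕ.<ᵇ t)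
<ᵇ-suc zero    zero    m≢t = ⊥-elim (m≢t refl)
<ᵇ-suc zero    (suc t) m≢t = refl
<ᵇ-suc (suc m) zero    m≢t = refl
<ᵇ-suc (suc m) (suc t) m≢t = <ᵇ-suc m t (m≢t ∘ cong suc)

<ᵇ-irrefl : ∀ t → (t ℕ.<ᵇ t) ≡ false
<ᵇ-irrefl zero    = refl
<ᵇ-irrefl (suc t) = <ᵇ-irrefl t

<ᵇ-suc-self : ∀ t → (t ℕ.<ᵇ suc t) ≡ true
<ᵇ-suc-self zero    = refl
<ᵇ-suc-self (suc t) = <ᵇ-suc-self t

<⇒<ᵇ≡true : ∀ m t → m ℕ.< t → (m ℕ.<ᵇ t) ≡ true
<⇒<ᵇ≡true zero    (suc t) _         = refl
<⇒<ᵇ≡true (suc m) (suc t) (ℕ.s≤s p) = <⇒<ᵇ≡true m t p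

-- Rows in P are changed one at a time, in increasing order; each change may only consult rows outside P.
module RowwiseChange {N} (P : Fin N → Bool) (f : Fin N → ℤ) (M M′ : Matrix N)
  (unchanged : ∀ a b → P a ≡ false → M′ a b ≡ M a b)
  (change : ∀ a → P a ≡ true → ∀ (X : Matrix N) → (∀ a′ b → P a′ ≡ false → X a′ b ≡ M a′ b) →
            (∀ b → X a b ≡ M a b) → det (replaceRow X a (M′ a)) ≡ f a * det X) where

  done : ℕ → Fin N → Bool
  done t a = P a ∧ (toℕ a ℕ.<ᵇ t)

  stage : ℕ → Matrix N
  stage t a b = if done t a then M′ a b else M a b

  factor : ℕ → Fin N → ℤ
  factor t a = if done t a then f a else 1ℤ

  done-suc : ∀ t a → toℕ a ≢ t → done (suc t) a ≡ done t a
  done-suc t a a≢t = cong (P a ∧_) (<ᵇ-suc (toℕ a) t a≢t)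

  done-0 : ∀ a → done 0 a ≡ false
  done-0 a with P a
  ... | true  = refl
  ... | false = refl

  stage-cong : ∀ t t′ a b → done t a ≡ done t′ a → stage t a b ≡ stage t′ a b
  stage-cong t t′ a b eq = cong (λ d → if d then M′ a b else M a b) eq

  factor-cong : ∀ t t′ a → done t a ≡ done t′ a → factor t a ≡ factor t′ a
  factor-cong t t′ a eq = cong (λ d → if d then f a else 1ℤ) eq

  stage-pending : ∀ t a b → done t a ≡ false → stage t a b ≡ M a b
  stage-pending t a b eq rewrite eq = refl

  invariant : ∀ t → det (stage t) ≡ Π (factor t) * det M
  invariant zero = begin
    det (stage 0)          ≡⟨ det-cong _ _ (λ a b → stage-pending 0 a b (done-0 a)) ⟩
    det M                  ≡⟨ sym (ℤ.*-identityˡ _) ⟩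
    1ℤ * det M             ≡⟨ cong (_* det M) (sym (Π-ones (factor 0) ones)) ⟩
    Π (factor 0) * det M   ∎
    where
    open ≡-Reasoning
    ones : ∀ a → factor 0 a ≡ 1ℤ
    ones a rewrite done-0 a = refl
  invariant (suc t) with t ℕ.<? N
  ... | no t≮N = trans (det-cong _ _ (λ a b → stage-cong (suc t) t a b (done-suc t a (beyond a))))
                   (trans (invariant t) (cong (_* det M) (Π-cong (λ a → factor-cong t (suc t) a (sym (done-suc t a (beyond a)))))))
    where
    beyond : ∀ a → toℕ a ≢ t
    beyond a eq = t≮N (subst (ℕ._< N) eq (toℕ<n a))
  ... | yes t<N = step (P row) refl
    where
    row : Fin N
    row = Fin.fromℕ< t<N
    toℕ-row : toℕ row ≡ t
    toℕ-row = toℕ-fromℕ< t<N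
    other : ∀ a → a ≢ row → toℕ a ≢ t
    other a a≢row eq = a≢row (toℕ-injective (trans eq (sym toℕ-row)))
    before : done t row ≡ false
    before rewrite toℕ-row | <ᵇ-irrefl t with P row
    ... | true  = refl
    ... | false = refl
    after : done (suc t) row ≡ P row
    after rewrite toℕ-row | <ᵇ-suc-self t with P row
    ... | true  = refl
    ... | false = refl
    step : ∀ p → P row ≡ p → det (stage (suc t)) ≡ Π (factor (suc t)) * det M
    step false P-row = trans (det-cong _ _ (λ a b → stage-cong (suc t) t a b (same a)))
                         (trans (invariant t) (cong (_* det M) (Π-cong (λ a → factor-cong t (suc t) a (sym (same a))))))
      where
      same : ∀ a → done (suc t) a ≡ done t a
      same a with a Fin.≟ row
      ... | yes refl   = trans after (trans P-row (sym before))
      ... | no  a≢row  = done-suc t a (other a a≢row)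
    step true P-row = begin
      det (stage (suc t))
        ≡⟨ det-cong _ _ replaced ⟩
      det (replaceRow (stage t) row (M′ row))
        ≡⟨ change row P-row (stage t) (λ a′ b P-a′ → stage-pending t a′ b (P-false⇒pending P-a′))
                  (λ b → stage-pending t row b before) ⟩
      f row * det (stage t)
        ≡⟨ cong (f row *_) (invariant t) ⟩
      f row * (Π (factor t) * det M)
        ≡⟨ sym (ℤ.*-assoc (f row) _ _) ⟩
      (f row * Π (factor t)) * det M
        ≡⟨ cong (_* det M) factors ⟩
      Π (factor (suc t)) * det M ∎
      where
      open ≡-Reasoning
      P-false⇒pending : ∀ {a} → P a ≡ false → done t a ≡ false
      P-false⇒pending {a} P-a rewrite P-a = refl
      replaced : ∀ a b → stage (suc t) a b ≡ replaceRow (stage t) row (M′ row) a b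
      replaced a b with a Fin.≟ row
      ... | yes refl  = cong (λ d → if d then M′ a b else M a b) (trans after P-row)
      ... | no  a≢row = stage-cong (suc t) t a b (done-suc t a (other a a≢row))
      factor-row : factor (suc t) row ≡ f row
      factor-row rewrite after | P-row = refl
      factor-row-before : factor t row ≡ 1ℤ
      factor-row-before rewrite before = refl
      factors : f row * Π (factor t) ≡ Π (factor (suc t))
      factors = begin
        f row * Π (factor t)                     ≡⟨ cong (_* Π (factor t)) (sym factor-row) ⟩
        factor (suc t) row * Π (factor t)        ≡⟨ Π-exchange (factor (suc t)) (factor t) row
                                                      (λ a a≢row → factor-cong (suc t) t a (done-suc t a (other a a≢row))) ⟩
        factor t row * Π (factor (suc t))        ≡⟨ cong (_* Π (factor (suc t))) factor-row-before ⟩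
        1ℤ * Π (factor (suc t))                  ≡⟨ ℤ.*-identityˡ _ ⟩
        Π (factor (suc t))                       ∎

  det-rowwise : det M′ ≡ Π (λ a → if P a then f a else 1ℤ) * det M
  det-rowwise = trans (det-cong _ _ final) (trans (invariant N) (cong (_* det M) (Π-cong (λ a → cong (λ d → if d then f a else 1ℤ) (all-done a)))))
    where
    all-done : ∀ a → done N a ≡ P a
    all-done a rewrite <⇒<ᵇ≡true (toℕ a) N (toℕ<n a) with P a
    ... | true  = refl
    ... | false = refl
    final : ∀ a b → M′ a b ≡ stage N a b
    final a b = by-P (P a) refl
      where
      by-P : ∀ p → P a ≡ p → M′ a b ≡ stage N a b
      by-P true  P-a = cong (λ d → if d then M′ a b else M a b) (sym (trans (all-done a) P-a))
      by-P false P-a = trans (unchanged a b P-a) (sym (stage-pending N a b (trans (all-done a) P-a)))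

det-rowwise-scale : ∀ {N} (P : Fin N → Bool) (s : ℤ) (M M′ : Matrix N) →
                    (∀ a b → P a ≡ false → M′ a b ≡ M a b) → (∀ a b → P a ≡ true → M′ a b ≡ s * M a b) →
                    det M′ ≡ s ^ count P * det M
det-rowwise-scale {N} P s M M′ unchanged scaled =
  trans (RowwiseChange.det-rowwise P (λ _ → s) M M′ unchanged change) (cong (_* det M) (Π-count P s))
  where
  change : ∀ a → P a ≡ true → ∀ (X : Matrix N) → (∀ a′ b → P a′ ≡ false → X a′ b ≡ M a′ b) →
           (∀ b → X a b ≡ M a b) → det (replaceRow X a (M′ a)) ≡ s * det X
  change a P-a X _ X-a = det-scaleRow X (replaceRow X a (M′ a)) a s (replaceRow-≢ X a (M′ a))
    (λ b → trans (replaceRow-≡ X a (M′ a) b) (trans (scaled a b P-a) (cong (s *_) (sym (X-a b)))))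

det-rowwise-add : ∀ {N} (P : Fin N → Bool) (M M′ : Matrix N) (W : Fin N → Fin N → Fin N → ℤ) →
                  (∀ a b → P a ≡ false → M′ a b ≡ M a b) →
                  (∀ a → P a ≡ true → ∀ t → Dependent (λ k → P k ≡ false) M (W a t)) →
                  (∀ a b → P a ≡ true → M′ a b ≡ M a b + Σ (λ t → W a t b)) → det M′ ≡ det M
det-rowwise-add {N} P M M′ W unchanged dependent added = begin
  det M′                                         ≡⟨ RowwiseChange.det-rowwise P (λ _ → 1ℤ) M M′ unchanged change ⟩
  Π (λ a → if P a then 1ℤ else 1ℤ) * det M       ≡⟨ cong (_* det M) (Π-ones _ (λ a → if-same (P a))) ⟩
  1ℤ * det M                                     ≡⟨ ℤ.*-identityˡ _ ⟩
  det M                                          ∎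
  where
  open ≡-Reasoning
  if-same : ∀ (p : Bool) → (if p then 1ℤ else 1ℤ) ≡ 1ℤ
  if-same true  = refl
  if-same false = refl
  change : ∀ a → P a ≡ true → ∀ (X : Matrix N) → (∀ a′ b → P a′ ≡ false → X a′ b ≡ M a′ b) →
           (∀ b → X a b ≡ M a b) → det (replaceRow X a (M′ a)) ≡ 1ℤ * det X
  change a P-a X X≈M X-a = trans
    (det-add-Σ N X (replaceRow X a (M′ a)) a (W a)
       (λ t → Dependent-transfer (λ P-k k≡a → true≢false (trans (sym P-a) (trans (cong P (sym k≡a)) P-k)))
                                 (λ k b P-k → sym (X≈M k b P-k)) (dependent a P-a t))
       (replaceRow-≢ X a (M′ a))
       (λ b → trans (replaceRow-≡ X a (M′ a) b) (trans (added a b P-a) (cong (_+ Σ (λ t → W a t b)) (sym (X-a b))))))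
    (sym (ℤ.*-identityˡ _))
    where
    true≢false : true ≢ false
    true≢false ()

-- The field F and the space Fⁿ

module FieldTheory (F : FiniteField) where
  open FiniteField F using (Carrier; 0#; 1#; 0≢1; inverse; q; enum; isCommutativeRing)

  commutativeRing : CommutativeRing 0ℓ 0ℓ
  commutativeRing = record { isCommutativeRing = isCommutativeRing }

  open CommutativeRing commutativeRing
    using (*-assoc; *-comm; *-identityˡ; *-identityʳ; zeroˡ; zeroʳ; distribʳ; +-identityˡ; -‿inverseˡ; -‿inverseʳ)
    renaming (_+_ to _+ᶠ_; _*_ to _*ᶠ_; -_ to -ᶠ_)
  open Algebra.Properties.Ring (CommutativeRing.ring commutativeRing) using (-1*x≈-x)
  open Algebra.Properties.Group (CommutativeRing.+-group commutativeRing) using (inverseˡ-unique)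

  infix 4 _≟_
  _≟_ : (x y : Carrier) → Dec (x ≡ y)
  _≟_ = inj⇒≟ (↔⇒↣ (↔-sym enum))

  1≢0 : 1# ≢ 0#
  1≢0 = 0≢1 ∘ sym

  -- 0⁻¹ is junk (= 0).
  _⁻¹ : Carrier → Carrier
  x ⁻¹ with x ≟ 0#
  ... | yes _   = 0#
  ... | no  x≢0 = proj₁ (inverse x x≢0)

  ⁻¹-inverseʳ : ∀ x → x ≢ 0# → x *ᶠ (x ⁻¹) ≡ 1#
  ⁻¹-inverseʳ x x≢0 with x ≟ 0#
  ... | yes x≡0 = ⊥-elim (x≢0 x≡0)
  ... | no  x≢0 = proj₂ (inverse x x≢0)

  ⁻¹-inverseˡ : ∀ x → x ≢ 0# → (x ⁻¹) *ᶠ x ≡ 1#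
  ⁻¹-inverseˡ x x≢0 = trans (*-comm _ _) (⁻¹-inverseʳ x x≢0)

  ⁻¹-cancelˡ : ∀ x y → x ≢ 0# → (x ⁻¹) *ᶠ (x *ᶠ y) ≡ y
  ⁻¹-cancelˡ x y x≢0 = trans (sym (*-assoc _ _ _)) (trans (cong (_*ᶠ y) (⁻¹-inverseˡ x x≢0)) (*-identityˡ y))

  *-cancelˡ : ∀ c x y → c ≢ 0# → c *ᶠ x ≡ c *ᶠ y → x ≡ y
  *-cancelˡ c x y c≢0 eq = trans (sym (⁻¹-cancelˡ c x c≢0)) (trans (cong ((c ⁻¹) *ᶠ_) eq) (⁻¹-cancelˡ c y c≢0))

  *-zero-divisor : ∀ x y → x ≢ 0# → x *ᶠ y ≡ 0# → y ≡ 0#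
  *-zero-divisor x y x≢0 xy≡0 = *-cancelˡ x y 0# x≢0 (trans xy≡0 (sym (zeroʳ x)))

  *-≢0 : ∀ {x y} → x ≢ 0# → y ≢ 0# → x *ᶠ y ≢ 0#
  *-≢0 {x} {y} x≢0 y≢0 = y≢0 ∘ *-zero-divisor x y x≢0

  ⁻¹-unique : ∀ x y → x *ᶠ y ≡ 1# → y ≡ x ⁻¹
  ⁻¹-unique x y xy≡1 = *-cancelˡ x y (x ⁻¹) x≢0 (trans xy≡1 (sym (⁻¹-inverseʳ x x≢0)))
    where
    x≢0 : x ≢ 0#
    x≢0 x≡0 = 0≢1 (trans (sym (zeroˡ y)) (trans (cong (_*ᶠ y) (sym x≡0)) xy≡1))

  -1≢0 : -ᶠ 1# ≢ 0#
  -1≢0 -1≡0 = 0≢1 (trans (sym (-‿inverseˡ 1#)) (trans (cong (_+ᶠ 1#) -1≡0) (+-identityˡ 1#)))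

  +≡0⇒≡-1* : ∀ x y → x +ᶠ y ≡ 0# → x ≡ (-ᶠ 1#) *ᶠ y
  +≡0⇒≡-1* x y x+y≡0 = trans (inverseˡ-unique x y x+y≡0) (sym (-1*x≈-x y))

  𝟎 : ∀ {n} → V F n
  𝟎 = zeroV F

  infixr 7 _·_
  _·_ : ∀ {n} → Carrier → V F n → V F n
  _·_ = _•_ F

  infix 4 _≟ᵛ_
  _≟ᵛ_ : ∀ {n} (u v : V F n) → Dec (u ≡ v)
  _≟ᵛ_ = Vec.≡-dec _≟_

  ·-assoc : ∀ {n} c d (v : V F n) → c · d · v ≡ (c *ᶠ d) · v
  ·-assoc c d []      = refl
  ·-assoc c d (x ∷ v) = cong₂ _∷_ (sym (*-assoc c d x)) (·-assoc c d v)

  ·-identity : ∀ {n} (v : V F n) → 1# · v ≡ v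
  ·-identity []      = refl
  ·-identity (x ∷ v) = cong₂ _∷_ (*-identityˡ x) (·-identity v)

  ·-zeroˡ : ∀ {n} (v : V F n) → 0# · v ≡ 𝟎
  ·-zeroˡ []      = refl
  ·-zeroˡ (x ∷ v) = cong₂ _∷_ (zeroˡ x) (·-zeroˡ v)

  ·-zeroʳ : ∀ {n} c → c · 𝟎 {n} ≡ 𝟎
  ·-zeroʳ {zero}  c = refl
  ·-zeroʳ {suc n} c = cong₂ _∷_ (zeroʳ c) (·-zeroʳ c)

  ⊕-𝟎 : ∀ {n} → _⊕_ F (𝟎 {n}) 𝟎 ≡ 𝟎
  ⊕-𝟎 {zero}  = refl
  ⊕-𝟎 {suc n} = cong₂ _∷_ (+-identityˡ 0#) ⊕-𝟎

  ·-distribʳ : ∀ {n} a b (v : V F n) → _⊕_ F (a · v) (b · v) ≡ (a +ᶠ b) · v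
  ·-distribʳ a b []      = refl
  ·-distribʳ a b (x ∷ v) = cong₂ _∷_ (sym (distribʳ x a b)) (·-distribʳ a b v)

  ⊕≡𝟎⇒≡-1· : ∀ {n} (u w : V F n) → _⊕_ F u w ≡ 𝟎 → u ≡ (-ᶠ 1#) · w
  ⊕≡𝟎⇒≡-1· []      []      _  = refl
  ⊕≡𝟎⇒≡-1· (x ∷ u) (y ∷ w) eq = cong₂ _∷_ (+≡0⇒≡-1* x y (Vec.∷-injectiveˡ eq)) (⊕≡𝟎⇒≡-1· u w (Vec.∷-injectiveʳ eq))

  ·≡𝟎 : ∀ {n} c (v : V F n) → c ≢ 0# → c · v ≡ 𝟎 → v ≡ 𝟎
  ·≡𝟎 c []      c≢0 _  = refl
  ·≡𝟎 c (x ∷ v) c≢0 eq = cong₂ _∷_ (*-zero-divisor c x c≢0 (Vec.∷-injectiveˡ eq)) (·≡𝟎 c v c≢0 (Vec.∷-injectiveʳ eq))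

  ·-cancelʳ : ∀ {n} c c′ (v : V F n) → v ≢ 𝟎 → c · v ≡ c′ · v → c ≡ c′
  ·-cancelʳ c c′ []      v≢0 eq = ⊥-elim (v≢0 refl)
  ·-cancelʳ c c′ (x ∷ v) v≢0 eq with x ≟ 0#
  ... | yes x≡0 = ·-cancelʳ c c′ v (λ v≡0 → v≢0 (cong₂ _∷_ x≡0 v≡0)) (Vec.∷-injectiveʳ eq)
  ... | no  x≢0 = *-cancelˡ x c c′ x≢0 (trans (*-comm x c) (trans (Vec.∷-injectiveˡ eq) (*-comm c′ x)))

  -- The canonical representative of the line through v.
  normalize : ∀ {n} → V F n → V F n
  normalize []      = []
  normalize (c ∷ v) with c ≟ 0#
  ... | yes _ = 0# ∷ normalize v
  ... | no  _ = 1# ∷ ((c ⁻¹) · v)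

  normalize-0∷ : ∀ {n} c (v : V F n) → c ≡ 0# → normalize (c ∷ v) ≡ 0# ∷ normalize v
  normalize-0∷ c v c≡0 with c ≟ 0#
  ... | yes _   = refl
  ... | no  c≢0 = ⊥-elim (c≢0 c≡0)

  normalize-unit∷ : ∀ {n} c (v : V F n) → c ≢ 0# → normalize (c ∷ v) ≡ 1# ∷ ((c ⁻¹) · v)
  normalize-unit∷ c v c≢0 with c ≟ 0#
  ... | yes c≡0 = ⊥-elim (c≢0 c≡0)
  ... | no  p   = cong (λ t → 1# ∷ (t · v)) (sym (⁻¹-unique c _ (proj₂ (inverse c p))))

  normalize-· : ∀ {n} c (v : V F n) → c ≢ 0# → normalize (c · v) ≡ normalize v
  normalize-· c []      c≢0 = refl
  normalize-· c (d ∷ v) c≢0 with d ≟ 0#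
  ... | yes d≡0 = trans (normalize-0∷ (c *ᶠ d) (c · v) (trans (cong (c *ᶠ_) d≡0) (zeroʳ c)))
                        (cong (0# ∷_) (normalize-· c v c≢0))
  ... | no  d≢0 = trans (normalize-unit∷ (c *ᶠ d) (c · v) (*-≢0 c≢0 d≢0))
                        (cong (1# ∷_) (trans (·-assoc _ c v) (cong (_· v) inverse-of-product)))
    where
    inverse-of-product : ((c *ᶠ d) ⁻¹) *ᶠ c ≡ d ⁻¹
    inverse-of-product = ⁻¹-unique d (((c *ᶠ d) ⁻¹) *ᶠ c)
      (trans (*-comm _ _) (trans (*-assoc _ _ _) (⁻¹-inverseˡ (c *ᶠ d) (*-≢0 c≢0 d≢0))))

  ≡·normalize : ∀ {n} (v : V F n) → v ≢ 𝟎 → ∃ λ c → c ≢ 0# × v ≡ c · normalize v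
  ≡·normalize []      v≢0 = ⊥-elim (v≢0 refl)
  ≡·normalize (d ∷ v) v≢0 with d ≟ 0#
  ... | yes d≡0 with ≡·normalize v (λ v≡0 → v≢0 (cong₂ _∷_ d≡0 v≡0))
  ...   | c , c≢0 , v≡c·v′ = c , c≢0 , cong₂ _∷_ (trans d≡0 (sym (zeroʳ c))) v≡c·v′
  ≡·normalize (d ∷ v) v≢0 | no d≢0 = d , d≢0 , cong₂ _∷_ (sym (*-identityʳ d)) (sym rescaled)
    where
    rescaled : d · ((d ⁻¹) · v) ≡ v
    rescaled = trans (·-assoc d (d ⁻¹) v) (trans (cong (_· v) (⁻¹-inverseʳ d d≢0)) (·-identity v))

  normalize-≢𝟎 : ∀ {n} (v : V F n) → v ≢ 𝟎 → normalize v ≢ 𝟎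
  normalize-≢𝟎 v v≢0 nv≡0 with ≡·normalize v v≢0
  ... | c , _ , v≡c·nv = v≢0 (trans v≡c·nv (trans (cong (c ·_) nv≡0) (·-zeroʳ c)))

  normalize-idem : ∀ {n} (v : V F n) → v ≢ 𝟎 → normalize (normalize v) ≡ normalize v
  normalize-idem v v≢0 with ≡·normalize v v≢0
  ... | c , c≢0 , v≡c·nv = sym (trans (cong normalize v≡c·nv) (normalize-· c (normalize v) c≢0))

  LinDep-𝟎ˡ : ∀ {n} (w : V F n) → LinDep F 𝟎 w
  LinDep-𝟎ˡ w = 1# , 0# , (1≢0 ∘ proj₁) , trans (cong₂ (_⊕_ F) (·-zeroʳ 1#) (·-zeroˡ w)) ⊕-𝟎

  LinDep-𝟎ʳ : ∀ {n} (u : V F n) → LinDep F u 𝟎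
  LinDep-𝟎ʳ u = 0# , 1# , (1≢0 ∘ proj₂) , trans (cong₂ (_⊕_ F) (·-zeroˡ u) (·-zeroʳ 1#)) ⊕-𝟎

  normalize⇒LinDep : ∀ {n} (u w : V F n) → u ≢ 𝟎 → w ≢ 𝟎 → normalize u ≡ normalize w → LinDep F u w
  normalize⇒LinDep u w u≢0 w≢0 same with ≡·normalize u u≢0 | ≡·normalize w w≢0
  ... | a , _ , u≡a·ρ | b , b≢0 , w≡b·ρ′ = b , (-ᶠ 1#) *ᶠ a , (b≢0 ∘ proj₁) , vanishes
    where
    ρ = normalize u
    w≡b·ρ : w ≡ b · ρ
    w≡b·ρ = trans w≡b·ρ′ (cong (b ·_) (sym same))
    coefficients : (b *ᶠ a) +ᶠ (((-ᶠ 1#) *ᶠ a) *ᶠ b) ≡ 0#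
    coefficients = begin
      (b *ᶠ a) +ᶠ (((-ᶠ 1#) *ᶠ a) *ᶠ b)    ≡⟨ cong₂ _+ᶠ_ (*-comm b a) (trans (*-assoc _ a b) (-1*x≈-x (a *ᶠ b))) ⟩
      (a *ᶠ b) +ᶠ (-ᶠ (a *ᶠ b))            ≡⟨ -‿inverseʳ (a *ᶠ b) ⟩
      0#                                 ∎
      where open ≡-Reasoning
    vanishes : _⊕_ F (b · u) (((-ᶠ 1#) *ᶠ a) · w) ≡ 𝟎
    vanishes = trans (cong₂ (_⊕_ F) (trans (cong (b ·_) u≡a·ρ) (·-assoc b a ρ))
                                    (trans (cong (((-ᶠ 1#) *ᶠ a) ·_) w≡b·ρ) (·-assoc _ b ρ)))
                     (trans (·-distribʳ _ _ ρ) (trans (cong (_· ρ) coefficients) (·-zeroˡ ρ)))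

  LinDep⇒normalize : ∀ {n} (u w : V F n) → u ≢ 𝟎 → w ≢ 𝟎 → LinDep F u w → normalize u ≡ normalize w
  LinDep⇒normalize u w u≢0 w≢0 (a , b , nontrivial , vanishes) = by-cases (a ≟ 0#) (b ≟ 0#)
    where
    open ≡-Reasoning
    a·u≡-b·w : a · u ≡ (-ᶠ 1# *ᶠ b) · w
    a·u≡-b·w = trans (⊕≡𝟎⇒≡-1· (a · u) (b · w) vanishes) (·-assoc (-ᶠ 1#) b w)
    by-cases : Dec (a ≡ 0#) → Dec (b ≡ 0#) → normalize u ≡ normalize w
    by-cases (yes a≡0) (yes b≡0) = ⊥-elim (nontrivial (a≡0 , b≡0))
    by-cases (yes a≡0) (no  b≢0) = ⊥-elim (w≢0 (·≡𝟎 (-ᶠ 1# *ᶠ b) w (*-≢0 -1≢0 b≢0)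
                                     (trans (sym a·u≡-b·w) (trans (cong (_· u) a≡0) (·-zeroˡ u)))))
    by-cases (no  a≢0) (yes b≡0) = ⊥-elim (u≢0 (·≡𝟎 a u a≢0 (trans a·u≡-b·w
                                     (trans (cong (λ t → (-ᶠ 1# *ᶠ t) · w) b≡0)
                                       (trans (cong (_· w) (zeroʳ (-ᶠ 1#))) (·-zeroˡ w))))))
    by-cases (no  a≢0) (no  b≢0) = begin
      normalize u                      ≡⟨ sym (normalize-· a u a≢0) ⟩
      normalize (a · u)                ≡⟨ cong normalize a·u≡-b·w ⟩
      normalize ((-ᶠ 1# *ᶠ b) · w)     ≡⟨ normalize-· (-ᶠ 1# *ᶠ b) w (*-≢0 -1≢0 b≢0) ⟩
      normalize w                      ∎

  OnLine : ∀ {n} → V F n → V F n → Set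
  OnLine ρ w = w ≢ 𝟎 × normalize w ≡ ρ

  onLine? : ∀ {n} (ρ w : V F n) → Dec (OnLine ρ w)
  onLine? ρ w = ¬? (w ≟ᵛ 𝟎) ×-dec (normalize w ≟ᵛ ρ)

  IsRepresentative : ∀ {n} → V F n → Set
  IsRepresentative w = OnLine w w

  representative? : ∀ {n} (w : V F n) → Dec (IsRepresentative w)
  representative? w = onLine? w w

  IsOrdinary : ∀ {n} → V F n → Set
  IsOrdinary w = w ≢ 𝟎 × normalize w ≢ w

  ordinary? : ∀ {n} (w : V F n) → Dec (IsOrdinary w)
  ordinary? w = ¬? (w ≟ᵛ 𝟎) ×-dec ¬? (normalize w ≟ᵛ w)

  representative-normalize : ∀ {n} (w : V F n) → w ≢ 𝟎 → IsRepresentative (normalize w)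
  representative-normalize w w≢0 = normalize-≢𝟎 w w≢0 , normalize-idem w w≢0

  representative-1∷𝟎 : ∀ {n} → IsRepresentative (1# ∷ 𝟎 {n})
  representative-1∷𝟎 = (λ eq → 1≢0 (Vec.∷-injectiveˡ eq)) , trans (normalize-unit∷ 1# 𝟎 1≢0) (cong (1# ∷_) (·-zeroʳ (1# ⁻¹)))

  representative-0∷ : ∀ {n} {v : V F n} → IsRepresentative v → IsRepresentative (0# ∷ v)
  representative-0∷ {v = v} (v≢0 , nv≡v) = (λ eq → v≢0 (Vec.∷-injectiveʳ eq)) , trans (normalize-0∷ 0# v refl) (cong (0# ∷_) nv≡v)

  normalize-F¹ : ∀ (v : V F 1) → v ≢ 𝟎 → normalize v ≡ 1# ∷ []
  normalize-F¹ (c ∷ []) v≢0 = normalize-unit∷ c [] (λ c≡0 → v≢0 (cong (_∷ []) c≡0))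

  q≥2 : ∃ λ r → q ≡ suc (suc r)
  q≥2 = at-least-two q enum
    where
    at-least-two : ∀ m → Fin m ↔ Carrier → ∃ λ r → m ≡ suc (suc r)
    at-least-two zero          e = ⊥-elim (Fin0-empty (Inverse.from e 0#))
      where
      Fin0-empty : Fin 0 → ⊥
      Fin0-empty ()
    at-least-two (suc zero)    e = ⊥-elim (0≢1 (trans (sym (Inverse.strictlyInverseˡ e 0#))
                                     (trans (cong (Inverse.to e) (Fin1-unique _ _)) (Inverse.strictlyInverseˡ e 1#))))
      where
      Fin1-unique : ∀ (i j : Fin 1) → i ≡ j
      Fin1-unique zero zero = refl
    at-least-two (suc (suc r)) e = r , refl

  Fin-q^n↔V : ∀ n → Fin (q ^ℕ n) ↔ V F n
  Fin-q^n↔V zero    = mk↔ₛ′ (λ _ → []) (λ _ → zero) (λ { [] → refl }) (λ { zero → refl })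
  Fin-q^n↔V (suc n) = ↔-trans (*↔× {q} {q ^ℕ n}) (↔-trans (enum ×-↔ Fin-q^n↔V n) ∷↔)
    where
    ∷↔ : (Carrier × V F n) ↔ V F (suc n)
    ∷↔ = mk↔ₛ′ (λ (c , v) → c ∷ v) (λ { (c ∷ v) → c , v }) (λ { (c ∷ v) → refl }) (λ { (c , v) → refl })

  |V|≡q^n : ∀ n N → Fin N ↔ V F n → N ≡ q ^ℕ n
  |V|≡q^n n N e = ↔⇒≡ (↔-trans e (↔-sym (Fin-q^n↔V n)))

-- The linear dependence graph

module LinearDependenceGraph (F : FiniteField) (n : ℕ) {N : ℕ} (e : Fin N ↔ V F n) where
  open FiniteField F using (Carrier; 0#; q; enum)
  open FieldTheory F

  vertex : Fin N → V F n
  vertex = Inverse.to e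

  index : V F n → Fin N
  index = Inverse.from e

  vertex-index : ∀ w → vertex (index w) ≡ w
  vertex-index = Inverse.strictlyInverseˡ e

  index-vertex : ∀ k → index (vertex k) ≡ k
  index-vertex = Inverse.strictlyInverseʳ e

  vertex-injective : ∀ {a b} → vertex a ≡ vertex b → a ≡ b
  vertex-injective {a} {b} eq = trans (sym (index-vertex a)) (trans (cong index eq) (index-vertex b))

  Σ-vertex-delta : ∀ (f : Fin N → ℤ) w → Σ (λ k → ⟦ vertex k ≟ᵛ w ⟧ * f k) ≡ f (index w)
  Σ-vertex-delta f w = trans (Σ-cong (λ k → cong (_* f k) (⟦⟧-cong vertex≡⇒ ⇒vertex≡ (vertex k ≟ᵛ w) (k Fin.≟ index w))))
                             (Σ-delta f (index w))
    where
    vertex≡⇒ : ∀ {k} → vertex k ≡ w → k ≡ index w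
    vertex≡⇒ {k} p = trans (sym (index-vertex k)) (cong index p)
    ⇒vertex≡ : ∀ {k} → k ≡ index w → vertex k ≡ w
    ⇒vertex≡ p = trans (cong vertex p) (vertex-index w)

  Σ-vertex-unique : ∀ w → Σ (λ k → ⟦ vertex k ≟ᵛ w ⟧) ≡ 1ℤ
  Σ-vertex-unique w = trans (Σ-cong {N} (λ k → sym (ℤ.*-identityʳ ⟦ vertex k ≟ᵛ w ⟧))) (Σ-vertex-delta (λ _ → 1ℤ) w)

  count-nonzero : Σ (λ k → ⟦ ¬? (vertex k ≟ᵛ 𝟎) ⟧) ≡ + N - 1ℤ
  count-nonzero = trans (Σ-¬ (λ k → vertex k ≟ᵛ 𝟎)) (cong (_-_ (+ N)) (Σ-vertex-unique 𝟎))

  scalar : Fin q → Carrier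
  scalar = Inverse.to enum

  count-units : Σ (λ c → ⟦ ¬? (scalar c ≟ 0#) ⟧) ≡ + q - 1ℤ
  count-units = trans (Σ-¬ (λ c → scalar c ≟ 0#)) (cong (_-_ (+ q)) (Σ-unique _ (Inverse.from enum 0#) 1ℤ zero-once))
    where
    zero-once : ∀ c → ⟦ scalar c ≟ 0# ⟧ ≡ ⟦ c Fin.≟ Inverse.from enum 0# ⟧ * 1ℤ
    zero-once c = trans (⟦⟧-cong (λ p → trans (sym (Inverse.strictlyInverseʳ enum c)) (cong (Inverse.from enum) p))
                                 (λ p → trans (cong scalar p) (Inverse.strictlyInverseˡ enum 0#))
                                 (scalar c ≟ 0#) (c Fin.≟ Inverse.from enum 0#))
                        (sym (ℤ.*-identityʳ _))

  module Line (ρ : V F n) (ρ-rep : IsRepresentative ρ) where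
    ρ≢0 : ρ ≢ 𝟎
    ρ≢0 = proj₁ ρ-rep

    onLine-multiples : ∀ w → ⟦ onLine? ρ w ⟧ ≡ Σ (λ c → ⟦ ¬? (scalar c ≟ 0#) ⟧ * ⟦ w ≟ᵛ scalar c · ρ ⟧)
    onLine-multiples w = multiples (onLine? ρ w)
      where
      multiples : (d : Dec (OnLine ρ w)) → ⟦ d ⟧ ≡ Σ (λ c → ⟦ ¬? (scalar c ≟ 0#) ⟧ * ⟦ w ≟ᵛ scalar c · ρ ⟧)
      multiples (yes (w≢0 , nw≡ρ)) with ≡·normalize w w≢0
      ... | c₀ , c₀≢0 , w≡c₀·nw = sym (Σ-unique _ (Inverse.from enum c₀) 1ℤ term)
        where
        w≡c₀·ρ : w ≡ c₀ · ρ
        w≡c₀·ρ = trans w≡c₀·nw (cong (c₀ ·_) nw≡ρ)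
        scalar-c₀ : scalar (Inverse.from enum c₀) ≡ c₀
        scalar-c₀ = Inverse.strictlyInverseˡ enum c₀
        term : ∀ c → ⟦ ¬? (scalar c ≟ 0#) ⟧ * ⟦ w ≟ᵛ scalar c · ρ ⟧ ≡ ⟦ c Fin.≟ Inverse.from enum c₀ ⟧ * 1ℤ
        term c with c Fin.≟ Inverse.from enum c₀
        ... | yes refl = ⟦⟧*⟦⟧-yes (¬? (scalar c ≟ 0#)) (w ≟ᵛ scalar c · ρ)
                           (subst (_≢ 0#) (sym scalar-c₀) c₀≢0) (trans w≡c₀·ρ (cong (_· ρ) (sym scalar-c₀)))
        ... | no  c≢   = ⟦⟧*⟦⟧-no (¬? (scalar c ≟ 0#)) (w ≟ᵛ scalar c · ρ) λ (_ , w≡cρ) →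
                           c≢ (trans (sym (Inverse.strictlyInverseʳ enum c))
                                     (cong (Inverse.from enum) (sym (·-cancelʳ c₀ (scalar c) ρ ρ≢0 (trans (sym w≡c₀·ρ) w≡cρ)))))
      multiples (no ¬onLine) = sym (Σ-zero _ λ c →
        ⟦⟧*⟦⟧-no (¬? (scalar c ≟ 0#)) (w ≟ᵛ scalar c · ρ) λ (c≢0 , w≡cρ) →
          ¬onLine ( (λ w≡0 → ρ≢0 (·≡𝟎 (scalar c) ρ c≢0 (trans (sym w≡cρ) w≡0)))
                  , trans (cong normalize w≡cρ) (trans (normalize-· (scalar c) ρ c≢0) (proj₂ ρ-rep))))

    line-size : Σ (λ k → ⟦ onLine? ρ (vertex k) ⟧) ≡ + q - 1ℤ
    line-size = begin
      Σ (λ k → ⟦ onLine? ρ (vertex k) ⟧)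
        ≡⟨ Σ-cong (onLine-multiples ∘ vertex) ⟩
      Σ (λ k → Σ (λ c → unit c * ⟦ vertex k ≟ᵛ scalar c · ρ ⟧))
        ≡⟨ Σ-comm (λ k c → unit c * ⟦ vertex k ≟ᵛ scalar c · ρ ⟧) ⟩
      Σ (λ c → Σ (λ k → unit c * ⟦ vertex k ≟ᵛ scalar c · ρ ⟧))
        ≡⟨ Σ-cong (λ c → trans (Σ-*ˡ (unit c) (λ k → ⟦ vertex k ≟ᵛ scalar c · ρ ⟧))
                           (trans (cong (unit c *_) (Σ-vertex-unique (scalar c · ρ))) (ℤ.*-identityʳ (unit c)))) ⟩
      Σ unit
        ≡⟨ count-units ⟩
      + q - 1ℤ ∎
      where
      open ≡-Reasoning
      unit : Fin q → ℤ
      unit c = ⟦ ¬? (scalar c ≟ 0#) ⟧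

    ordinary-on-line : ∀ w → ⟦ ordinary? w ⟧ * ⟦ normalize w ≟ᵛ ρ ⟧ ≡ ⟦ onLine? ρ w ⟧ - ⟦ w ≟ᵛ ρ ⟧
    ordinary-on-line w = by-cases (onLine? ρ w) (w ≟ᵛ ρ)
      where
      by-cases : (d : Dec (OnLine ρ w)) (d′ : Dec (w ≡ ρ)) → ⟦ ordinary? w ⟧ * ⟦ normalize w ≟ᵛ ρ ⟧ ≡ ⟦ d ⟧ - ⟦ d′ ⟧
      by-cases (yes (w≢0 , nw≡ρ)) (yes w≡ρ) =
        ⟦⟧*⟦⟧-no (ordinary? w) (normalize w ≟ᵛ ρ) (λ ((_ , nw≢w) , _) → nw≢w (trans nw≡ρ (sym w≡ρ)))
      by-cases (yes (w≢0 , nw≡ρ)) (no w≢ρ) =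
        ⟦⟧*⟦⟧-yes (ordinary? w) (normalize w ≟ᵛ ρ) (w≢0 , λ nw≡w → w≢ρ (trans (sym nw≡w) nw≡ρ)) nw≡ρ
      by-cases (no ¬onLine) (yes w≡ρ) = ⊥-elim (¬onLine (subst (OnLine ρ) (sym w≡ρ) ρ-rep))
      by-cases (no ¬onLine) (no _) =
        ⟦⟧*⟦⟧-no (ordinary? w) (normalize w ≟ᵛ ρ) (λ ((w≢0 , _) , nw≡ρ) → ¬onLine (w≢0 , nw≡ρ))

    ordinary-line-size : Σ (λ k → ⟦ ordinary? (vertex k) ⟧ * ⟦ normalize (vertex k) ≟ᵛ ρ ⟧) ≡ + q - 1ℤ - 1ℤ
    ordinary-line-size = begin
      Σ (λ k → ⟦ ordinary? (vertex k) ⟧ * ⟦ normalize (vertex k) ≟ᵛ ρ ⟧)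
        ≡⟨ Σ-cong (ordinary-on-line ∘ vertex) ⟩
      Σ (λ k → ⟦ onLine? ρ (vertex k) ⟧ - ⟦ vertex k ≟ᵛ ρ ⟧)
        ≡⟨ Σ-distrib-+ (λ k → ⟦ onLine? ρ (vertex k) ⟧) (λ k → - ⟦ vertex k ≟ᵛ ρ ⟧) ⟩
      Σ (λ k → ⟦ onLine? ρ (vertex k) ⟧) + Σ (λ k → - ⟦ vertex k ≟ᵛ ρ ⟧)
        ≡⟨ cong₂ _+_ line-size (trans (Σ-neg (λ k → ⟦ vertex k ≟ᵛ ρ ⟧)) (cong -_ (Σ-vertex-unique ρ))) ⟩
      + q - 1ℤ - 1ℤ ∎
      where open ≡-Reasoning

  nonzero-on-unique-line : ∀ w → ⟦ ¬? (w ≟ᵛ 𝟎) ⟧ ≡ Σ (λ j → ⟦ representative? (vertex j) ⟧ * ⟦ onLine? (vertex j) w ⟧)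
  nonzero-on-unique-line w = by-cases (w ≟ᵛ 𝟎)
    where
    by-cases : (d : Dec (w ≡ 𝟎)) → ⟦ ¬? d ⟧ ≡ Σ (λ j → ⟦ representative? (vertex j) ⟧ * ⟦ onLine? (vertex j) w ⟧)
    by-cases (yes w≡0) = sym (Σ-zero _ λ j →
      ⟦⟧*⟦⟧-no (representative? (vertex j)) (onLine? (vertex j) w) (λ (_ , w≢0 , _) → w≢0 w≡0))
    by-cases (no w≢0) = sym (Σ-unique _ (index (normalize w)) 1ℤ term)
      where
      term : ∀ j → ⟦ representative? (vertex j) ⟧ * ⟦ onLine? (vertex j) w ⟧ ≡ ⟦ j Fin.≟ index (normalize w) ⟧ * 1ℤ
      term j with j Fin.≟ index (normalize w)
      ... | yes refl = ⟦⟧*⟦⟧-yes (representative? (vertex j)) (onLine? (vertex j) w)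
                         (subst IsRepresentative (sym (vertex-index (normalize w))) (representative-normalize w w≢0))
                         (w≢0 , sym (vertex-index (normalize w)))
      ... | no  j≢   = ⟦⟧*⟦⟧-no (representative? (vertex j)) (onLine? (vertex j) w)
                         (λ (_ , _ , nw≡vj) → j≢ (trans (sym (index-vertex j)) (cong index (sym nw≡vj))))

  number-of-lines : Σ (λ j → ⟦ representative? (vertex j) ⟧) * (+ q - 1ℤ) ≡ + N - 1ℤ
  number-of-lines = begin
    Σ rep * (+ q - 1ℤ)
      ≡⟨ ℤ.*-comm (Σ rep) (+ q - 1ℤ) ⟩
    (+ q - 1ℤ) * Σ rep
      ≡⟨ sym (Σ-*ˡ (+ q - 1ℤ) rep) ⟩
    Σ (λ j → (+ q - 1ℤ) * rep j)
      ≡⟨ Σ-cong (λ j → trans (ℤ.*-comm (+ q - 1ℤ) (rep j)) (sym (by-line j (representative? (vertex j))))) ⟩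
    Σ (λ j → rep j * Σ (λ k → ⟦ onLine? (vertex j) (vertex k) ⟧))
      ≡⟨ Σ-cong (λ j → sym (Σ-*ˡ (rep j) (λ k → ⟦ onLine? (vertex j) (vertex k) ⟧))) ⟩
    Σ (λ j → Σ (λ k → rep j * ⟦ onLine? (vertex j) (vertex k) ⟧))
      ≡⟨ Σ-comm (λ j k → rep j * ⟦ onLine? (vertex j) (vertex k) ⟧) ⟩
    Σ (λ k → Σ (λ j → rep j * ⟦ onLine? (vertex j) (vertex k) ⟧))
      ≡⟨ sym (Σ-cong (nonzero-on-unique-line ∘ vertex)) ⟩
    Σ (λ k → ⟦ ¬? (vertex k ≟ᵛ 𝟎) ⟧)
      ≡⟨ count-nonzero ⟩
    + N - 1ℤ ∎
    where
    open ≡-Reasoning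
    rep : Fin N → ℤ
    rep j = ⟦ representative? (vertex j) ⟧
    by-line : ∀ j (d : Dec (IsRepresentative (vertex j))) →
              ⟦ d ⟧ * Σ (λ k → ⟦ onLine? (vertex j) (vertex k) ⟧) ≡ ⟦ d ⟧ * (+ q - 1ℤ)
    by-line j (yes vj-rep) = cong (1ℤ *_) (Line.line-size (vertex j) vj-rep)
    by-line j (no _)       = trans (ℤ.*-zeroˡ (Σ (λ k → ⟦ onLine? (vertex j) (vertex k) ⟧))) (sym (ℤ.*-zeroˡ (+ q - 1ℤ)))

  ordinary-fibre : ∀ w → Σ (λ t → ⟦ ordinary? (vertex t) ⟧ * ⟦ normalize (vertex t) ≟ᵛ w ⟧)
                         ≡ ⟦ representative? w ⟧ * (+ q - 1ℤ - 1ℤ)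
  ordinary-fibre w = by-cases (representative? w)
    where
    by-cases : (d : Dec (IsRepresentative w)) →
               Σ (λ t → ⟦ ordinary? (vertex t) ⟧ * ⟦ normalize (vertex t) ≟ᵛ w ⟧) ≡ ⟦ d ⟧ * (+ q - 1ℤ - 1ℤ)
    by-cases (yes w-rep) = trans (Line.ordinary-line-size w w-rep) (sym (ℤ.*-identityˡ _))
    by-cases (no ¬w-rep) = trans (Σ-zero _ λ t → ⟦⟧*⟦⟧-no (ordinary? (vertex t)) (normalize (vertex t) ≟ᵛ w)
                                   (λ ((vt≢0 , _) , nvt≡w) → ¬w-rep (subst IsRepresentative nvt≡w (representative-normalize (vertex t) vt≢0))))
                                 (sym (ℤ.*-zeroˡ (+ q - 1ℤ - 1ℤ)))

  -- The neighbours of a non-zero u are the origin and the other non-zero points of its line.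
  adjacency : V F n → V F n → ℤ
  adjacency u w with u ≟ᵛ 𝟎
  ... | yes _ = ⟦ ¬? (w ≟ᵛ 𝟎) ⟧
  ... | no  _ = ⟦ w ≟ᵛ 𝟎 ⟧ + ⟦ onLine? (normalize u) w ⟧ - ⟦ u ≟ᵛ w ⟧

  adjacency-𝟎 : ∀ w → adjacency 𝟎 w ≡ ⟦ ¬? (w ≟ᵛ 𝟎) ⟧
  adjacency-𝟎 w with 𝟎 {n} ≟ᵛ 𝟎
  ... | yes _   = refl
  ... | no  0≢0 = ⊥-elim (0≢0 refl)

  adjacency-≢𝟎 : ∀ u w → u ≢ 𝟎 → adjacency u w ≡ ⟦ w ≟ᵛ 𝟎 ⟧ + ⟦ onLine? (normalize u) w ⟧ - ⟦ u ≟ᵛ w ⟧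
  adjacency-≢𝟎 u w u≢0 with u ≟ᵛ 𝟎
  ... | yes u≡0 = ⊥-elim (u≢0 u≡0)
  ... | no  _   = refl

  Adj? : ∀ (u w : V F n) → Dec (Adj F u w)
  Adj? u w with u ≟ᵛ w
  ... | yes u≡w = no (λ (u≢w , _) → u≢w u≡w)
  ... | no  u≢w with u ≟ᵛ 𝟎 | w ≟ᵛ 𝟎
  ...   | yes u≡0 | _       = yes (u≢w , subst (λ t → LinDep F t w) (sym u≡0) (LinDep-𝟎ˡ w))
  ...   | no  _   | yes w≡0 = yes (u≢w , subst (LinDep F u) (sym w≡0) (LinDep-𝟎ʳ u))
  ...   | no  u≢0 | no  w≢0 with normalize u ≟ᵛ normalize w
  ...     | yes same = yes (u≢w , normalize⇒LinDep u w u≢0 w≢0 same)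
  ...     | no  diff = no (λ (_ , dep) → diff (LinDep⇒normalize u w u≢0 w≢0 dep))

  adjacency-Adj : ∀ (u w : V F n) → Adj F u w → adjacency u w ≡ 1ℤ
  adjacency-Adj u w (u≢w , dep) with u ≟ᵛ 𝟎
  ... | yes u≡0 = ⟦⟧-yes (¬? (w ≟ᵛ 𝟎)) (λ w≡0 → u≢w (trans u≡0 (sym w≡0)))
  ... | no  u≢0 = by-cases (w ≟ᵛ 𝟎)
    where
    by-cases : Dec (w ≡ 𝟎) → ⟦ w ≟ᵛ 𝟎 ⟧ + ⟦ onLine? (normalize u) w ⟧ - ⟦ u ≟ᵛ w ⟧ ≡ 1ℤ
    by-cases (yes w≡0) rewrite ⟦⟧-yes (w ≟ᵛ 𝟎) w≡0 | ⟦⟧-no (onLine? (normalize u) w) (λ (w≢0 , _) → w≢0 w≡0)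
                             | ⟦⟧-no (u ≟ᵛ w) u≢w = refl
    by-cases (no w≢0) rewrite ⟦⟧-no (w ≟ᵛ 𝟎) w≢0
                            | ⟦⟧-yes (onLine? (normalize u) w) (w≢0 , sym (LinDep⇒normalize u w u≢0 w≢0 dep))
                            | ⟦⟧-no (u ≟ᵛ w) u≢w = refl

  adjacency-¬Adj : ∀ (u w : V F n) → ¬ Adj F u w → adjacency u w ≡ 0ℤ
  adjacency-¬Adj u w ¬adj with u ≟ᵛ 𝟎
  ... | yes u≡0 = ⟦⟧-no (¬? (w ≟ᵛ 𝟎)) (λ w≢0 → ¬adj ((λ u≡w → w≢0 (trans (sym u≡w) u≡0)) ,
                                                       subst (λ t → LinDep F t w) (sym u≡0) (LinDep-𝟎ˡ w)))
  ... | no  u≢0 = by-cases (u ≟ᵛ w)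
    where
    w≢0 : u ≢ w → w ≢ 𝟎
    w≢0 u≢w w≡0 = ¬adj (u≢w , subst (LinDep F u) (sym w≡0) (LinDep-𝟎ʳ u))
    by-cases : Dec (u ≡ w) → ⟦ w ≟ᵛ 𝟎 ⟧ + ⟦ onLine? (normalize u) w ⟧ - ⟦ u ≟ᵛ w ⟧ ≡ 0ℤ
    by-cases (yes refl) rewrite ⟦⟧-no (u ≟ᵛ 𝟎) u≢0 | ⟦⟧-yes (onLine? (normalize u) u) (u≢0 , refl)
                              | ⟦⟧-yes (u ≟ᵛ u) refl = refl
    by-cases (no u≢w) rewrite ⟦⟧-no (w ≟ᵛ 𝟎) (w≢0 u≢w)
                            | ⟦⟧-no (onLine? (normalize u) w) (λ (w≢0′ , nw≡nu) → ¬adj (u≢w , normalize⇒LinDep u w u≢0 w≢0′ (sym nw≡nu)))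
                            | ⟦⟧-no (u ≟ᵛ w) u≢w = refl

  degree : V F n → ℤ
  degree u = Σ (λ k → adjacency u (vertex k))

  degree-𝟎 : degree 𝟎 ≡ + N - 1ℤ
  degree-𝟎 = trans (Σ-cong (adjacency-𝟎 ∘ vertex)) count-nonzero

  degree-≢𝟎 : ∀ u → u ≢ 𝟎 → degree u ≡ + q - 1ℤ
  degree-≢𝟎 u u≢0 = begin
    Σ (λ k → adjacency u (vertex k))
      ≡⟨ Σ-cong (λ k → adjacency-≢𝟎 u (vertex k) u≢0) ⟩
    Σ (λ k → ⟦ vertex k ≟ᵛ 𝟎 ⟧ + ⟦ onLine? ρ (vertex k) ⟧ - ⟦ u ≟ᵛ vertex k ⟧)
      ≡⟨ Σ-distrib-+ (λ k → ⟦ vertex k ≟ᵛ 𝟎 ⟧ + ⟦ onLine? ρ (vertex k) ⟧) (λ k → - ⟦ u ≟ᵛ vertex k ⟧) ⟩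
    Σ (λ k → ⟦ vertex k ≟ᵛ 𝟎 ⟧ + ⟦ onLine? ρ (vertex k) ⟧) + Σ (λ k → - ⟦ u ≟ᵛ vertex k ⟧)
      ≡⟨ cong₂ _+_ (Σ-distrib-+ (λ k → ⟦ vertex k ≟ᵛ 𝟎 ⟧) (λ k → ⟦ onLine? ρ (vertex k) ⟧))
                   (Σ-neg (λ k → ⟦ u ≟ᵛ vertex k ⟧)) ⟩
    (Σ (λ k → ⟦ vertex k ≟ᵛ 𝟎 ⟧) + Σ (λ k → ⟦ onLine? ρ (vertex k) ⟧)) - Σ (λ k → ⟦ u ≟ᵛ vertex k ⟧)
      ≡⟨ cong₂ _-_ (cong₂ _+_ (Σ-vertex-unique 𝟎) (Line.line-size ρ (representative-normalize u u≢0)))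
                   (trans (Σ-cong (λ k → ⟦⟧-sym (u ≟ᵛ vertex k) (vertex k ≟ᵛ u))) (Σ-vertex-unique u)) ⟩
    (1ℤ + (+ q - 1ℤ)) - 1ℤ
      ≡⟨ lem (+ q) ⟩
    + q - 1ℤ ∎
    where
    open ≡-Reasoning
    ρ = normalize u
    lem : ∀ a → (1ℤ + (a - 1ℤ)) - 1ℤ ≡ a - 1ℤ
    lem = solve-∀

  data Kind : Set where
    origin representative ordinary : Kind

  kind : V F n → Kind
  kind u with u ≟ᵛ 𝟎 | normalize u ≟ᵛ u
  ... | yes _ | _     = origin
  ... | no  _ | yes _ = representative
  ... | no  _ | no  _ = ordinary

  data KindSpec (u : V F n) : Kind → Set where
    origin         : u ≡ 𝟎 → KindSpec u origin
    representative : IsRepresentative u → KindSpec u representative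
    ordinary       : IsOrdinary u → KindSpec u ordinary

  kind-spec : ∀ u → KindSpec u (kind u)
  kind-spec u with u ≟ᵛ 𝟎 | normalize u ≟ᵛ u
  ... | yes u≡0 | _        = origin u≡0
  ... | no  u≢0 | yes nu≡u = representative (u≢0 , nu≡u)
  ... | no  u≢0 | no  nu≢u = ordinary (u≢0 , nu≢u)

  kind-𝟎 : ∀ {u} → u ≡ 𝟎 → kind u ≡ origin
  kind-𝟎 {u} u≡0 with kind u | kind-spec u
  ... | origin         | _                          = refl
  ... | representative | representative (u≢0 , _) = ⊥-elim (u≢0 u≡0)
  ... | ordinary       | ordinary (u≢0 , _)       = ⊥-elim (u≢0 u≡0)

  kind-representative : ∀ {u} → IsRepresentative u → kind u ≡ representative
  kind-representative {u} (u≢0 , nu≡u) with kind u | kind-spec u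
  ... | origin         | origin u≡0              = ⊥-elim (u≢0 u≡0)
  ... | representative | _                       = refl
  ... | ordinary       | ordinary (_ , nu≢u)    = ⊥-elim (nu≢u nu≡u)

  isOrigin isRepresentative isOrdinary : Kind → Bool
  isOrigin origin = true
  isOrigin _      = false
  isRepresentative representative = true
  isRepresentative _              = false
  isOrdinary ordinary = true
  isOrdinary _        = false

  ⟦origin⟧ : ∀ u → ⟦ u ≟ᵛ 𝟎 ⟧ ≡ (if isOrigin (kind u) then 1ℤ else 0ℤ)
  ⟦origin⟧ u with kind u | kind-spec u
  ... | origin         | origin u≡0                = ⟦⟧-yes (u ≟ᵛ 𝟎) u≡0
  ... | representative | representative (u≢0 , _) = ⟦⟧-no (u ≟ᵛ 𝟎) u≢0
  ... | ordinary       | ordinary (u≢0 , _)       = ⟦⟧-no (u ≟ᵛ 𝟎) u≢0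

  ⟦representative⟧ : ∀ u → ⟦ representative? u ⟧ ≡ (if isRepresentative (kind u) then 1ℤ else 0ℤ)
  ⟦representative⟧ u with kind u | kind-spec u
  ... | origin         | origin u≡0           = ⟦⟧-no (representative? u) (λ (u≢0 , _) → u≢0 u≡0)
  ... | representative | representative rep  = ⟦⟧-yes (representative? u) rep
  ... | ordinary       | ordinary (_ , nu≢u) = ⟦⟧-no (representative? u) (λ (_ , nu≡u) → nu≢u nu≡u)

  ⟦ordinary⟧ : ∀ u → ⟦ ordinary? u ⟧ ≡ (if isOrdinary (kind u) then 1ℤ else 0ℤ)
  ⟦ordinary⟧ u with kind u | kind-spec u
  ... | origin         | origin u≡0                 = ⟦⟧-no (ordinary? u) (λ (u≢0 , _) → u≢0 u≡0)
  ... | representative | representative (_ , nu≡u) = ⟦⟧-no (ordinary? u) (λ (_ , nu≢u) → nu≢u nu≡u)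
  ... | ordinary       | ordinary ord               = ⟦⟧-yes (ordinary? u) ord

  nonzero-split : ∀ w → ⟦ ¬? (w ≟ᵛ 𝟎) ⟧ ≡ ⟦ representative? w ⟧ + ⟦ ordinary? w ⟧
  nonzero-split w rewrite ⟦representative⟧ w | ⟦ordinary⟧ w with kind w | kind-spec w
  ... | origin         | origin w≡0                = ⟦⟧-no (¬? (w ≟ᵛ 𝟎)) (λ w≢0 → w≢0 w≡0)
  ... | representative | representative (w≢0 , _) = ⟦⟧-yes (¬? (w ≟ᵛ 𝟎)) w≢0
  ... | ordinary       | ordinary (w≢0 , _)       = ⟦⟧-yes (¬? (w ≟ᵛ 𝟎)) w≢0

  isOrdinary⇒ : ∀ {u} → isOrdinary (kind u) ≡ true → IsOrdinary u
  isOrdinary⇒ {u} eq with kind u | kind-spec u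
  isOrdinary⇒ () | origin | _
  isOrdinary⇒ () | representative | _
  isOrdinary⇒ _  | ordinary | ordinary ord = ord

  kind-ordinary : ∀ {u} → IsOrdinary u → isOrdinary (kind u) ≡ true
  kind-ordinary {u} (u≢0 , nu≢u) with kind u | kind-spec u
  ... | origin         | origin u≡0                = ⊥-elim (u≢0 u≡0)
  ... | representative | representative (_ , nu≡u) = ⊥-elim (nu≢u nu≡u)
  ... | ordinary       | _                         = refl

  originVertex representativeVertex ordinaryVertex : Fin N → Bool
  originVertex a = isOrigin (kind (vertex a))
  representativeVertex a = isRepresentative (kind (vertex a))
  ordinaryVertex a = isOrdinary (kind (vertex a))

  count-originVertex : count originVertex ≡ 1
  count-originVertex = ℤ.+-injective (begin
    + count originVertex                        ≡⟨ sym (Σ-count originVertex) ⟩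
    Σ (λ k → if originVertex k then 1ℤ else 0ℤ)  ≡⟨ sym (Σ-cong (⟦origin⟧ ∘ vertex)) ⟩
    Σ (λ k → ⟦ vertex k ≟ᵛ 𝟎 ⟧)                   ≡⟨ Σ-vertex-unique 𝟎 ⟩
    1ℤ                                        ∎)
    where open ≡-Reasoning


  Σ-representative : Σ (λ k → ⟦ representative? (vertex k) ⟧) ≡ + count representativeVertex
  Σ-representative = trans (Σ-cong (⟦representative⟧ ∘ vertex)) (Σ-count representativeVertex)

  Σ-ordinary : Σ (λ k → ⟦ ordinary? (vertex k) ⟧) ≡ + count ordinaryVertex
  Σ-ordinary = trans (Σ-cong (⟦ordinary⟧ ∘ vertex)) (Σ-count ordinaryVertex)

  count-lines : + count representativeVertex * (+ q - 1ℤ) ≡ + N - 1ℤ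
  count-lines = trans (cong (_* (+ q - 1ℤ)) (sym Σ-representative)) number-of-lines

  count-nonzero-split : + N - 1ℤ ≡ + count representativeVertex + + count ordinaryVertex
  count-nonzero-split = begin
    + N - 1ℤ                                                   ≡⟨ sym count-nonzero ⟩
    Σ (λ k → ⟦ ¬? (vertex k ≟ᵛ 𝟎) ⟧)                            ≡⟨ Σ-cong (nonzero-split ∘ vertex) ⟩
    Σ (λ k → ⟦ representative? (vertex k) ⟧ + ⟦ ordinary? (vertex k) ⟧)
      ≡⟨ Σ-distrib-+ (λ k → ⟦ representative? (vertex k) ⟧) (λ k → ⟦ ordinary? (vertex k) ⟧) ⟩
    Σ (λ k → ⟦ representative? (vertex k) ⟧) + Σ (λ k → ⟦ ordinary? (vertex k) ⟧)
      ≡⟨ cong₂ _+_ Σ-representative Σ-ordinary ⟩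
    + count representativeVertex + + count ordinaryVertex       ∎
    where open ≡-Reasoning

-- Row reduction of xI - L

module Reduction (F : FiniteField) (n : ℕ) {N : ℕ} (e : Fin N ↔ V F n)
                 (A : Matrix N) (A-adjacency : IsAdjacencyMatrix F n e A) where
  open FiniteField F using (q)
  open FieldTheory F
  open LinearDependenceGraph F n e

  A≡adjacency : ∀ i k → A i k ≡ adjacency (vertex i) (vertex k)
  A≡adjacency i k with Adj? (vertex i) (vertex k)
  ... | yes adj = trans (proj₁ (A-adjacency i k) adj) (sym (adjacency-Adj _ _ adj))
  ... | no ¬adj = trans (proj₂ (A-adjacency i k) ¬adj) (sym (adjacency-¬Adj _ _ ¬adj))

  δ[_,_] : V F n → V F n → ℤ
  δ[ u , w ] = ⟦ u ≟ᵛ w ⟧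

  δ-vertex : ∀ a b → δ a b ≡ δ[ vertex a , vertex b ]
  δ-vertex a b with a Fin.≟ b
  ... | yes refl = sym (⟦⟧-yes (vertex a ≟ᵛ vertex a) refl)
  ... | no  a≢b  = sym (⟦⟧-no (vertex a ≟ᵛ vertex b) (a≢b ∘ vertex-injective))

  𝟙𝟎 𝟙rep 𝟙ord : V F n → ℤ
  𝟙𝟎 w = ⟦ w ≟ᵛ 𝟎 ⟧
  𝟙rep w = ⟦ representative? w ⟧
  𝟙ord w = ⟦ ordinary? w ⟧

  -- Matrices are described row by row: the rule for row u may depend on the kind of u.
  RowRule : Set
  RowRule = Kind → V F n → V F n → ℤ

  matrix : RowRule → Matrix N
  matrix r a b = r (kind (vertex a)) (vertex a) (vertex b)

  charRow : ℤ → V F n → V F n → ℤ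
  charRow x u w = (x - degree u) * δ[ u , w ] + adjacency u w

  charMatrix-rows : ∀ x a b → charMatrix x (laplacian A) a b ≡ charRow x (vertex a) (vertex b)
  charMatrix-rows x a b rewrite δ-vertex a b | Σ-cong (A≡adjacency a) | A≡adjacency a b =
    lem x δ[ vertex a , vertex b ] (degree (vertex a)) (adjacency (vertex a) (vertex b))
    where
    lem : ∀ x d D a → x * d - (d * D - a) ≡ (x - D) * d + a
    lem = solve-∀

  originIndex : Fin N
  originIndex = index 𝟎

  lineIndex : Fin N → Fin N
  lineIndex a = index (normalize (vertex a))

  vertex-lineIndex : ∀ a → vertex (lineIndex a) ≡ normalize (vertex a)
  vertex-lineIndex a = vertex-index (normalize (vertex a))

  module OrdinaryRow (a : Fin N) (a-ord : ordinaryVertex a ≡ true) where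
    ordinary-vertex : IsOrdinary (vertex a)
    ordinary-vertex = isOrdinary⇒ a-ord

    vertex≢𝟎 : vertex a ≢ 𝟎
    vertex≢𝟎 = proj₁ ordinary-vertex

    lineIndex-representative : kind (vertex (lineIndex a)) ≡ representative
    lineIndex-representative =
      kind-representative (subst IsRepresentative (sym (vertex-lineIndex a)) (representative-normalize (vertex a) vertex≢𝟎))

    lineIndex-not-ordinary : ordinaryVertex (lineIndex a) ≡ false
    lineIndex-not-ordinary = cong isOrdinary lineIndex-representative

  matrix-row : ∀ r a {k} → kind (vertex a) ≡ k → ∀ b → matrix r a b ≡ r k (vertex a) (vertex b)
  matrix-row r a eq b rewrite eq = refl

  isOrdinary-true : ∀ {k} → isOrdinary k ≡ true → k ≡ ordinary
  isOrdinary-true {ordinary} _ = refl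

  charRow-≢𝟎 : ∀ x u w → u ≢ 𝟎 → charRow x u w ≡ (x - (+ q - 1ℤ)) * δ[ u , w ] + (𝟙𝟎 w + ⟦ onLine? (normalize u) w ⟧ - δ[ u , w ])
  charRow-≢𝟎 x u w u≢0 = cong₂ (λ d a → (x - d) * δ[ u , w ] + a) (degree-≢𝟎 u u≢0) (adjacency-≢𝟎 u w u≢0)

  stage₁ : ℤ → RowRule
  stage₁ x ordinary u w = δ[ u , w ] - δ[ normalize u , w ]
  stage₁ x _        u w = charRow x u w

  -- Subtracting from each ordinary row the row of its line representative leaves (x - q)(eᵤ - e_ρ).
  det-charMatrix-stage₁ : ∀ x → det (charMatrix x (laplacian A)) ≡ (x - + q) ^ count ordinaryVertex * det (matrix (stage₁ x))
  det-charMatrix-stage₁ x = begin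
    det M₀                                                    ≡⟨ sym (det-rowwise-add ordinaryVertex M₀ (matrix scaled) W unchanged dependent added) ⟩
    det (matrix scaled)
      ≡⟨ det-rowwise-scale ordinaryVertex (x - + q) (matrix (stage₁ x)) (matrix scaled) kept rescaled ⟩
    (x - + q) ^ count ordinaryVertex * det (matrix (stage₁ x))   ∎
    where
    open ≡-Reasoning
    M₀ = charMatrix x (laplacian A)
    scaled : RowRule
    scaled ordinary u w = (x - + q) * stage₁ x ordinary u w
    scaled k        u w = stage₁ x k u w
    W : Fin N → Fin N → Fin N → ℤ
    W a t b = ⟦ t Fin.≟ lineIndex a ⟧ * (- M₀ t b)
    unchanged : ∀ a b → ordinaryVertex a ≡ false → matrix scaled a b ≡ M₀ a b
    unchanged a b P-a with kind (vertex a)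
    unchanged a b _  | origin         = sym (charMatrix-rows x a b)
    unchanged a b _  | representative = sym (charMatrix-rows x a b)
    unchanged a b () | ordinary
    dependent : ∀ a → ordinaryVertex a ≡ true → ∀ t → Dependent (λ k → ordinaryVertex k ≡ false) M₀ (W a t)
    dependent a a-ord t with t Fin.≟ lineIndex a
    ... | yes refl = multiple-of-row (lineIndex a) -1ℤ (OrdinaryRow.lineIndex-not-ordinary a a-ord)
                       (λ b → trans (ℤ.*-identityˡ _) (sym (ℤ.-1*i≡-i _)))
    ... | no  _    = zero-vector (λ b → ℤ.*-zeroˡ (- M₀ t b))
    added : ∀ a b → ordinaryVertex a ≡ true → matrix scaled a b ≡ M₀ a b + Σ (λ t → W a t b)
    added a b a-ord = sym (begin
      M₀ a b + Σ (λ t → W a t b)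
        ≡⟨ cong₂ _+_ (charMatrix-rows x a b) (Σ-delta (λ t → - M₀ t b) (lineIndex a)) ⟩
      charRow x u w + - M₀ (lineIndex a) b
        ≡⟨ cong (λ t → charRow x u w + - t) (trans (charMatrix-rows x (lineIndex a) b) (cong (λ v → charRow x v w) (vertex-lineIndex a))) ⟩
      charRow x u w - charRow x ρ w
        ≡⟨ cong₂ _-_ (charRow-≢𝟎 x u w u≢0)
                     (trans (charRow-≢𝟎 x ρ w ρ≢0)
                            (cong (λ v → (x - (+ q - 1ℤ)) * δ[ ρ , w ] + (𝟙𝟎 w + ⟦ onLine? v w ⟧ - δ[ ρ , w ])) (normalize-idem u u≢0))) ⟩
      ((x - (+ q - 1ℤ)) * δ[ u , w ] + (𝟙𝟎 w + ⟦ onLine? ρ w ⟧ - δ[ u , w ]))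
        - ((x - (+ q - 1ℤ)) * δ[ ρ , w ] + (𝟙𝟎 w + ⟦ onLine? ρ w ⟧ - δ[ ρ , w ]))
        ≡⟨ lem x (+ q) δ[ u , w ] δ[ ρ , w ] (𝟙𝟎 w + ⟦ onLine? ρ w ⟧) ⟩
      (x - + q) * (δ[ u , w ] - δ[ ρ , w ])
        ≡⟨ sym (matrix-row scaled a (isOrdinary-true a-ord) b) ⟩
      matrix scaled a b ∎)
      where
      u = vertex a
      w = vertex b
      ρ = normalize u
      u≢0 = OrdinaryRow.vertex≢𝟎 a a-ord
      ρ≢0 = normalize-≢𝟎 u u≢0
      lem : ∀ x q δu δρ c → ((x - (q - 1ℤ)) * δu + (c - δu)) - ((x - (q - 1ℤ)) * δρ + (c - δρ)) ≡ (x - q) * (δu - δρ)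
      lem = solve-∀
    kept : ∀ a b → ordinaryVertex a ≡ false → matrix scaled a b ≡ matrix (stage₁ x) a b
    kept a b P-a with kind (vertex a)
    kept a b _  | origin         = refl
    kept a b _  | representative = refl
    kept a b () | ordinary
    rescaled : ∀ a b → ordinaryVertex a ≡ true → matrix scaled a b ≡ (x - + q) * matrix (stage₁ x) a b
    rescaled a b P-a with kind (vertex a)
    rescaled a b () | origin
    rescaled a b () | representative
    rescaled a b _  | ordinary = refl

  ordinary-row-negated : ∀ x t b → 𝟙ord (vertex t) * (- matrix (stage₁ x) t b)
                                   ≡ 𝟙ord (vertex t) * δ[ normalize (vertex t) , vertex b ] - 𝟙ord (vertex t) * δ[ vertex t , vertex b ]
  ordinary-row-negated x t b rewrite ⟦ordinary⟧ (vertex t) with kind (vertex t)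
  ... | ordinary = lem δ[ vertex t , vertex b ] δ[ normalize (vertex t) , vertex b ]
    where
    lem : ∀ a r → 1ℤ * (- (a - r)) ≡ 1ℤ * r - 1ℤ * a
    lem = solve-∀
  ... | origin = lem (charRow x (vertex t) (vertex b)) δ[ normalize (vertex t) , vertex b ] δ[ vertex t , vertex b ]
    where
    lem : ∀ m r a → 0ℤ * (- m) ≡ 0ℤ * r - 0ℤ * a
    lem = solve-∀
  ... | representative = lem (charRow x (vertex t) (vertex b)) δ[ normalize (vertex t) , vertex b ] δ[ vertex t , vertex b ]
    where
    lem : ∀ m r a → 0ℤ * (- m) ≡ 0ℤ * r - 0ℤ * a
    lem = solve-∀

  Σ-ordinary-rows : ∀ x b → Σ (λ t → 𝟙ord (vertex t) * (- matrix (stage₁ x) t b))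
                            ≡ 𝟙rep (vertex b) * (+ q - 1ℤ - 1ℤ) - 𝟙ord (vertex b)
  Σ-ordinary-rows x b = begin
    Σ (λ t → 𝟙ord (vertex t) * (- matrix (stage₁ x) t b))
      ≡⟨ Σ-cong (λ t → ordinary-row-negated x t b) ⟩
    Σ (λ t → 𝟙ord (vertex t) * δ[ normalize (vertex t) , w ] - 𝟙ord (vertex t) * δ[ vertex t , w ])
      ≡⟨ Σ-distrib-+ (λ t → 𝟙ord (vertex t) * δ[ normalize (vertex t) , w ]) (λ t → - (𝟙ord (vertex t) * δ[ vertex t , w ])) ⟩
    Σ (λ t → 𝟙ord (vertex t) * δ[ normalize (vertex t) , w ]) + Σ (λ t → - (𝟙ord (vertex t) * δ[ vertex t , w ]))
      ≡⟨ cong₂ _+_ (ordinary-fibre w) (Σ-neg (λ t → 𝟙ord (vertex t) * δ[ vertex t , w ])) ⟩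
    𝟙rep w * (+ q - 1ℤ - 1ℤ) - Σ (λ t → 𝟙ord (vertex t) * δ[ vertex t , w ])
      ≡⟨ cong (λ s → 𝟙rep w * (+ q - 1ℤ - 1ℤ) - s) picks-w ⟩
    𝟙rep w * (+ q - 1ℤ - 1ℤ) - 𝟙ord w ∎
    where
    open ≡-Reasoning
    w = vertex b
    picks-w : Σ (λ t → 𝟙ord (vertex t) * δ[ vertex t , w ]) ≡ 𝟙ord w
    picks-w = trans (Σ-cong (λ t → ℤ.*-comm (𝟙ord (vertex t)) δ[ vertex t , w ]))
                    (trans (Σ-vertex-delta (𝟙ord ∘ vertex) w) (cong 𝟙ord (vertex-index w)))

  Σ-ordinary-rows-on-line : ∀ x b u → IsRepresentative u →
    Σ (λ t → (𝟙ord (vertex t) * δ[ normalize (vertex t) , u ]) * (- matrix (stage₁ x) t b))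
      ≡ δ[ u , vertex b ] * (+ q - 1ℤ - 1ℤ) - (⟦ onLine? u (vertex b) ⟧ - δ[ vertex b , u ])
  Σ-ordinary-rows-on-line x b u u-rep = begin
    Σ (λ t → (c t * on t) * (- matrix (stage₁ x) t b))
      ≡⟨ Σ-cong term ⟩
    Σ (λ t → δ[ u , w ] * (c t * on t) + - (δ[ vertex t , w ] * (c t * on t)))
      ≡⟨ Σ-distrib-+ (λ t → δ[ u , w ] * (c t * on t)) (λ t → - (δ[ vertex t , w ] * (c t * on t))) ⟩
    Σ (λ t → δ[ u , w ] * (c t * on t)) + Σ (λ t → - (δ[ vertex t , w ] * (c t * on t)))
      ≡⟨ cong₂ _+_ (trans (Σ-*ˡ δ[ u , w ] (λ t → c t * on t)) (cong (δ[ u , w ] *_) (Line.ordinary-line-size u u-rep)))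
                   (Σ-neg (λ t → δ[ vertex t , w ] * (c t * on t))) ⟩
    δ[ u , w ] * (+ q - 1ℤ - 1ℤ) - Σ (λ t → δ[ vertex t , w ] * (c t * on t))
      ≡⟨ cong (λ s → δ[ u , w ] * (+ q - 1ℤ - 1ℤ) - s) picks-w ⟩
    δ[ u , w ] * (+ q - 1ℤ - 1ℤ) - (⟦ onLine? u w ⟧ - δ[ w , u ]) ∎
    where
    open ≡-Reasoning
    w = vertex b
    c on : Fin N → ℤ
    c t = 𝟙ord (vertex t)
    on t = δ[ normalize (vertex t) , u ]
    on-line : ∀ t → on t * (c t * δ[ normalize (vertex t) , w ]) ≡ δ[ u , w ] * (c t * on t)
    on-line t with normalize (vertex t) ≟ᵛ u
    ... | yes refl = lem (c t) δ[ normalize (vertex t) , w ]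
      where
      lem : ∀ a b → 1ℤ * (a * b) ≡ b * (a * 1ℤ)
      lem = solve-∀
    ... | no  _    = lem (c t) δ[ normalize (vertex t) , w ] δ[ u , w ]
      where
      lem : ∀ a b d → 0ℤ * (a * b) ≡ d * (a * 0ℤ)
      lem = solve-∀
    term : ∀ t → (c t * on t) * (- matrix (stage₁ x) t b) ≡ δ[ u , w ] * (c t * on t) + - (δ[ vertex t , w ] * (c t * on t))
    term t = begin
      (c t * on t) * (- matrix (stage₁ x) t b)
        ≡⟨ lem₁ (c t) (on t) (- matrix (stage₁ x) t b) ⟩
      on t * (c t * (- matrix (stage₁ x) t b))
        ≡⟨ cong (on t *_) (ordinary-row-negated x t b) ⟩
      on t * (c t * δ[ normalize (vertex t) , w ] - c t * δ[ vertex t , w ])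
        ≡⟨ lem₂ (on t) (c t * δ[ normalize (vertex t) , w ]) (c t) δ[ vertex t , w ] ⟩
      on t * (c t * δ[ normalize (vertex t) , w ]) + - (on t * (c t * δ[ vertex t , w ]))
        ≡⟨ cong₂ _+_ (on-line t) (cong -_ (lem₃ (on t) (c t) δ[ vertex t , w ])) ⟩
      δ[ u , w ] * (c t * on t) + - (δ[ vertex t , w ] * (c t * on t)) ∎
      where
      lem₁ : ∀ a c m → (a * c) * m ≡ c * (a * m)
      lem₁ = solve-∀
      lem₂ : ∀ c X a e → c * (X - a * e) ≡ c * X + - (c * (a * e))
      lem₂ = solve-∀
      lem₃ : ∀ c a e → c * (a * e) ≡ e * (a * c)
      lem₃ = solve-∀
    picks-w : Σ (λ t → δ[ vertex t , w ] * (c t * on t)) ≡ ⟦ onLine? u w ⟧ - δ[ w , u ]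
    picks-w = trans (Σ-vertex-delta (λ t → c t * on t) w)
                    (trans (cong (λ v → 𝟙ord v * δ[ normalize v , u ]) (vertex-index w)) (Line.ordinary-on-line u u-rep w))

  stage₂ : ℤ → RowRule
  stage₂ x origin         u w = (x - + N + 1ℤ) * 𝟙𝟎 w + (+ q - 1ℤ) * 𝟙rep w
  stage₂ x representative u w = (x - 1ℤ) * δ[ u , w ] + 𝟙𝟎 w
  stage₂ x ordinary       u w = stage₁ x ordinary u w

  -- Adding the ordinary rows eᵤ - e_ρ clears the ordinary columns of the origin and representative rows.
  det-stage₂ : ∀ x → det (matrix (stage₂ x)) ≡ det (matrix (stage₁ x))
  det-stage₂ x = det-rowwise-add (not ∘ ordinaryVertex) M₁ (matrix (stage₂ x)) W unchanged dependent added
    where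
    M₁ = matrix (stage₁ x)
    coefficient : Kind → V F n → Fin N → ℤ
    coefficient origin         u t = 𝟙ord (vertex t)
    coefficient representative u t = 𝟙ord (vertex t) * δ[ normalize (vertex t) , u ]
    coefficient ordinary       u t = 0ℤ
    W : Fin N → Fin N → Fin N → ℤ
    W a t b = coefficient (kind (vertex a)) (vertex a) t * (- M₁ t b)
    unchanged : ∀ a b → not (ordinaryVertex a) ≡ false → matrix (stage₂ x) a b ≡ M₁ a b
    unchanged a b P-a with kind (vertex a)
    unchanged a b () | origin
    unchanged a b () | representative
    unchanged a b _  | ordinary = refl
    coefficient-ordinary : ∀ k u t → ¬ IsOrdinary (vertex t) → coefficient k u t ≡ 0ℤ
    coefficient-ordinary origin         u t ¬ord = ⟦⟧-no (ordinary? (vertex t)) ¬ord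
    coefficient-ordinary representative u t ¬ord = cong (_* δ[ normalize (vertex t) , u ]) (⟦⟧-no (ordinary? (vertex t)) ¬ord)
    coefficient-ordinary ordinary       u t ¬ord = refl
    dependent : ∀ a → not (ordinaryVertex a) ≡ true → ∀ t → Dependent (λ k → not (ordinaryVertex k) ≡ false) M₁ (W a t)
    dependent a _ t with ordinary? (vertex t)
    ... | yes t-ord = multiple-of-row t (- c) (cong not (kind-ordinary t-ord))
                        (λ b → trans (sym (ℤ.neg-distribʳ-* c (M₁ t b))) (ℤ.neg-distribˡ-* c (M₁ t b)))
      where
      c = coefficient (kind (vertex a)) (vertex a) t
    ... | no ¬t-ord = zero-vector (λ b → trans (cong (_* (- M₁ t b)) (coefficient-ordinary (kind (vertex a)) (vertex a) t ¬t-ord))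
                                             (ℤ.*-zeroˡ (- M₁ t b)))
    added : ∀ a b → not (ordinaryVertex a) ≡ true → matrix (stage₂ x) a b ≡ M₁ a b + Σ (λ t → W a t b)
    added a b P-a with kind (vertex a) | kind-spec (vertex a)
    added a b () | ordinary | _
    added a b _  | origin   | origin a≡0 = sym (begin
      charRow x (vertex a) w + Σ (λ t → 𝟙ord (vertex t) * (- M₁ t b))
        ≡⟨ cong₂ _+_ (cong (λ v → charRow x v w) a≡0) (Σ-ordinary-rows x b) ⟩
      charRow x 𝟎 w + (R * (+ q - 1ℤ - 1ℤ) - O)
        ≡⟨ cong (_+ (R * (+ q - 1ℤ - 1ℤ) - O)) (cong₂ (λ d a → (x - d) * δ[ 𝟎 , w ] + a) degree-𝟎 (adjacency-𝟎 w)) ⟩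
      ((x - (+ N - 1ℤ)) * δ[ 𝟎 , w ] + ⟦ ¬? (w ≟ᵛ 𝟎) ⟧) + (R * (+ q - 1ℤ - 1ℤ) - O)
        ≡⟨ cong (_+ (R * (+ q - 1ℤ - 1ℤ) - O))
                (cong₂ (λ d s → (x - (+ N - 1ℤ)) * d + s) (⟦⟧-sym (𝟎 ≟ᵛ w) (w ≟ᵛ 𝟎)) (nonzero-split w)) ⟩
      ((x - (+ N - 1ℤ)) * Z + (R + O)) + (R * (+ q - 1ℤ - 1ℤ) - O)
        ≡⟨ lem x (+ N) (+ q) Z R O ⟩
      (x - + N + 1ℤ) * Z + (+ q - 1ℤ) * R ∎)
      where
      open ≡-Reasoning
      w = vertex b
      Z = 𝟙𝟎 w
      R = 𝟙rep w
      O = 𝟙ord w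
      lem : ∀ x N q Z R O → ((x - (N - 1ℤ)) * Z + (R + O)) + (R * (q - 1ℤ - 1ℤ) - O) ≡ (x - N + 1ℤ) * Z + (q - 1ℤ) * R
      lem = solve-∀
    added a b _  | representative | representative (u≢0 , nu≡u) = sym (begin
      charRow x u w + Σ (λ t → (𝟙ord (vertex t) * δ[ normalize (vertex t) , u ]) * (- M₁ t b))
        ≡⟨ cong₂ _+_ (charRow-≢𝟎 x u w u≢0) (Σ-ordinary-rows-on-line x b u (u≢0 , nu≡u)) ⟩
      ((x - (+ q - 1ℤ)) * d + (Z + ⟦ onLine? (normalize u) w ⟧ - d)) + (d * (+ q - 1ℤ - 1ℤ) - (⟦ onLine? u w ⟧ - δ[ w , u ]))
        ≡⟨ cong₂ (λ L d′ → ((x - (+ q - 1ℤ)) * d + (Z + L - d)) + (d * (+ q - 1ℤ - 1ℤ) - (⟦ onLine? u w ⟧ - d′)))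
                 (cong (λ v → ⟦ onLine? v w ⟧) nu≡u) (⟦⟧-sym (w ≟ᵛ u) (u ≟ᵛ w)) ⟩
      ((x - (+ q - 1ℤ)) * d + (Z + ⟦ onLine? u w ⟧ - d)) + (d * (+ q - 1ℤ - 1ℤ) - (⟦ onLine? u w ⟧ - d))
        ≡⟨ lem x (+ q) d Z ⟦ onLine? u w ⟧ ⟩
      (x - 1ℤ) * d + Z ∎)
      where
      open ≡-Reasoning
      u = vertex a
      w = vertex b
      d = δ[ u , w ]
      Z = 𝟙𝟎 w
      lem : ∀ x q d Z L → ((x - (q - 1ℤ)) * d + (Z + L - d)) + (d * (q - 1ℤ - 1ℤ) - (L - d)) ≡ (x - 1ℤ) * d + Z
      lem = solve-∀

  origin-kind : kind (vertex originIndex) ≡ origin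
  origin-kind = kind-𝟎 (vertex-index 𝟎)

  not-origin : ∀ a → a ≢ originIndex → ∀ {k} → KindSpec (vertex a) k → k ≢ origin
  not-origin a a≢o (origin a≡0) refl = a≢o (trans (sym (index-vertex a)) (cong index a≡0))
  not-origin a a≢o (representative _) ()
  not-origin a a≢o (ordinary _) ()

  agree-off-origin : ∀ (r r′ : RowRule) → (∀ u w → r representative u w ≡ r′ representative u w) →
                     (∀ u w → r ordinary u w ≡ r′ ordinary u w) → RowsAgreeExcept originIndex (matrix r′) (matrix r)
  agree-off-origin r r′ same-rep same-ord a b a≢o with kind (vertex a) | kind-spec (vertex a)
  ... | origin         | spec = ⊥-elim (not-origin a a≢o spec refl)
  ... | representative | _    = same-rep (vertex a) (vertex b)
  ... | ordinary       | _    = same-ord (vertex a) (vertex b)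

  stage₃ : ℤ → RowRule
  stage₃ x origin u w = (x * (x - + N)) * 𝟙𝟎 w
  stage₃ x k      u w = stage₂ x k u w

  -- Scale the origin row by x - 1, then subtract q - 1 times every representative row.
  det-stage₃ : ∀ x → det (matrix (stage₃ x)) ≡ (x - 1ℤ) * det (matrix (stage₂ x))
  det-stage₃ x = begin
    det (matrix (stage₃ x))   ≡⟨ det-add-Σ N (matrix scaled) (matrix (stage₃ x)) originIndex W dependent
                                    (agree-off-origin (stage₃ x) scaled (λ _ _ → refl) (λ _ _ → refl)) origin-row ⟩
    det (matrix scaled)       ≡⟨ det-scaleRow (matrix (stage₂ x)) (matrix scaled) originIndex (x - 1ℤ)
                                    (agree-off-origin scaled (stage₂ x) (λ _ _ → refl) (λ _ _ → refl))
                                    (λ b → trans (matrix-row scaled originIndex origin-kind b)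
                                                 (sym (cong ((x - 1ℤ) *_) (matrix-row (stage₂ x) originIndex origin-kind b)))) ⟩
    (x - 1ℤ) * det (matrix (stage₂ x)) ∎
    where
    open ≡-Reasoning
    scaled : RowRule
    scaled origin u w = (x - 1ℤ) * stage₂ x origin u w
    scaled k      u w = stage₂ x k u w
    c = - (+ q - 1ℤ)
    W : Fin N → Fin N → ℤ
    W t b = (c * 𝟙rep (vertex t)) * matrix scaled t b
    dependent : ∀ t → Dependent (_≢ originIndex) (matrix scaled) (W t)
    dependent t = by-cases (representative? (vertex t))
      where
      by-cases : Dec (IsRepresentative (vertex t)) → Dependent (_≢ originIndex) (matrix scaled) (W t)
      by-cases (yes t-rep) = multiple-of-row t (c * 1ℤ) (λ t≡o → proj₁ t-rep (trans (cong vertex t≡o) (vertex-index 𝟎)))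
                               (λ b → cong (λ s → (c * s) * matrix scaled t b) (⟦⟧-yes (representative? (vertex t)) t-rep))
      by-cases (no ¬t-rep) = zero-vector (λ b → trans (cong (λ s → (c * s) * matrix scaled t b) (⟦⟧-no (representative? (vertex t)) ¬t-rep))
                                                      (trans (cong (_* matrix scaled t b) (ℤ.*-zeroʳ c)) (ℤ.*-zeroˡ (matrix scaled t b))))
    W-split : ∀ b t → W t b ≡ (c * (x - 1ℤ)) * (δ[ vertex t , vertex b ] * 𝟙rep (vertex t)) + (c * 𝟙𝟎 (vertex b)) * 𝟙rep (vertex t)
    W-split b t = by-cases (representative? (vertex t))
      where
      by-cases : Dec (IsRepresentative (vertex t)) →
                 W t b ≡ (c * (x - 1ℤ)) * (δ[ vertex t , vertex b ] * 𝟙rep (vertex t)) + (c * 𝟙𝟎 (vertex b)) * 𝟙rep (vertex t)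
      by-cases (yes t-rep) rewrite ⟦⟧-yes (representative? (vertex t)) t-rep | kind-representative t-rep =
        lem c x δ[ vertex t , vertex b ] (𝟙𝟎 (vertex b))
        where
        lem : ∀ c x d Z → (c * 1ℤ) * ((x - 1ℤ) * d + Z) ≡ (c * (x - 1ℤ)) * (d * 1ℤ) + (c * Z) * 1ℤ
        lem = solve-∀
      by-cases (no ¬t-rep) rewrite ⟦⟧-no (representative? (vertex t)) ¬t-rep =
        lem c x δ[ vertex t , vertex b ] (𝟙𝟎 (vertex b)) (matrix scaled t b)
        where
        lem : ∀ c x d Z m → (c * 0ℤ) * m ≡ (c * (x - 1ℤ)) * (d * 0ℤ) + (c * Z) * 0ℤ
        lem = solve-∀
    ΣW : ∀ b → Σ (λ t → W t b) ≡ (c * (x - 1ℤ)) * 𝟙rep (vertex b) + (c * 𝟙𝟎 (vertex b)) * Σ (λ t → 𝟙rep (vertex t))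
    ΣW b = begin
      Σ (λ t → W t b)
        ≡⟨ Σ-cong (W-split b) ⟩
      Σ (λ t → (c * (x - 1ℤ)) * (δ[ vertex t , vertex b ] * 𝟙rep (vertex t)) + (c * 𝟙𝟎 (vertex b)) * 𝟙rep (vertex t))
        ≡⟨ Σ-distrib-+ (λ t → (c * (x - 1ℤ)) * (δ[ vertex t , vertex b ] * 𝟙rep (vertex t)))
                       (λ t → (c * 𝟙𝟎 (vertex b)) * 𝟙rep (vertex t)) ⟩
      Σ (λ t → (c * (x - 1ℤ)) * (δ[ vertex t , vertex b ] * 𝟙rep (vertex t))) + Σ (λ t → (c * 𝟙𝟎 (vertex b)) * 𝟙rep (vertex t))
        ≡⟨ cong₂ _+_ (trans (Σ-*ˡ (c * (x - 1ℤ)) (λ t → δ[ vertex t , vertex b ] * 𝟙rep (vertex t)))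
                            (cong ((c * (x - 1ℤ)) *_) (trans (Σ-vertex-delta (𝟙rep ∘ vertex) (vertex b)) (cong 𝟙rep (vertex-index (vertex b))))))
                     (Σ-*ˡ (c * 𝟙𝟎 (vertex b)) (λ t → 𝟙rep (vertex t))) ⟩
      (c * (x - 1ℤ)) * 𝟙rep (vertex b) + (c * 𝟙𝟎 (vertex b)) * Σ (λ t → 𝟙rep (vertex t)) ∎
    origin-row : ∀ b → matrix (stage₃ x) originIndex b ≡ matrix scaled originIndex b + Σ (λ t → W t b)
    origin-row b rewrite origin-kind | ΣW b = sym (begin
      (x - 1ℤ) * ((x - + N + 1ℤ) * Z + (+ q - 1ℤ) * R) + ((c * (x - 1ℤ)) * R + (c * Z) * Σ (λ t → 𝟙rep (vertex t)))
        ≡⟨ lem₁ x (+ N) (+ q) Z R (Σ (λ t → 𝟙rep (vertex t))) ⟩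
      (x - 1ℤ) * (x - + N + 1ℤ) * Z - Z * (Σ (λ t → 𝟙rep (vertex t)) * (+ q - 1ℤ))
        ≡⟨ cong (λ s → (x - 1ℤ) * (x - + N + 1ℤ) * Z - Z * s) number-of-lines ⟩
      (x - 1ℤ) * (x - + N + 1ℤ) * Z - Z * (+ N - 1ℤ)
        ≡⟨ lem₂ x (+ N) Z ⟩
      (x * (x - + N)) * Z ∎)
      where
      Z = 𝟙𝟎 (vertex b)
      R = 𝟙rep (vertex b)
      lem₁ : ∀ x N q Z R r → (x - 1ℤ) * ((x - N + 1ℤ) * Z + (q - 1ℤ) * R) + ((- (q - 1ℤ) * (x - 1ℤ)) * R + (- (q - 1ℤ) * Z) * r)
                              ≡ (x - 1ℤ) * (x - N + 1ℤ) * Z - Z * (r * (q - 1ℤ))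
      lem₁ = solve-∀
      lem₂ : ∀ x N Z → (x - 1ℤ) * (x - N + 1ℤ) * Z - Z * (N - 1ℤ) ≡ (x * (x - N)) * Z
      lem₂ = solve-∀

  diagonalRule : ℤ → RowRule
  diagonalRule x origin         u w = (x * (x - + N)) * 𝟙𝟎 w
  diagonalRule x representative u w = (x - 1ℤ) * δ[ u , w ]
  diagonalRule x ordinary       u w = δ[ u , w ]

  -- Clear 𝟙𝟎 from the representative rows with the origin row, then -e_ρ from the ordinary rows with row ρ.
  det-diagonalRule : ∀ x → det (matrix (diagonalRule x)) ≡ det (matrix (stage₃ x))
  det-diagonalRule x = begin
    det (matrix (diagonalRule x))  ≡⟨ det-rowwise-add ordinaryVertex (matrix stage₄) (matrix (diagonalRule x)) W₂ kept₂ dependent₂ added₂ ⟩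
    det (matrix stage₄)            ≡⟨ det-rowwise-add representativeVertex (matrix (stage₃ x)) (matrix stage₄) W₁ kept₁ dependent₁ added₁ ⟩
    det (matrix (stage₃ x))        ∎
    where
    open ≡-Reasoning
    stage₄ : RowRule
    stage₄ representative u w = (x - 1ℤ) * δ[ u , w ]
    stage₄ k              u w = stage₃ x k u w
    W₁ : Fin N → Fin N → Fin N → ℤ
    W₁ a t b = ⟦ t Fin.≟ originIndex ⟧ * (- 𝟙𝟎 (vertex b))
    kept₁ : ∀ a b → representativeVertex a ≡ false → matrix stage₄ a b ≡ matrix (stage₃ x) a b
    kept₁ a b P-a with kind (vertex a)
    kept₁ a b _  | origin         = refl
    kept₁ a b () | representative
    kept₁ a b _  | ordinary       = refl
    dependent₁ : ∀ a → representativeVertex a ≡ true → ∀ t → Dependent (λ k → representativeVertex k ≡ false) (matrix (stage₃ x)) (W₁ a t)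
    dependent₁ a _ t with t Fin.≟ originIndex
    ... | yes refl = row-multiple-of originIndex (- (x * (x - + N))) (cong isRepresentative origin-kind)
                       (λ b → trans (matrix-row (stage₃ x) originIndex origin-kind b) (lem (x * (x - + N)) (𝟙𝟎 (vertex b))))
      where
      lem : ∀ X Z → X * Z ≡ (- X) * (1ℤ * (- Z))
      lem = solve-∀
    ... | no  _    = zero-vector (λ b → ℤ.*-zeroˡ (- 𝟙𝟎 (vertex b)))
    added₁ : ∀ a b → representativeVertex a ≡ true → matrix stage₄ a b ≡ matrix (stage₃ x) a b + Σ (λ t → W₁ a t b)
    added₁ a b P-a rewrite Σ-delta (λ _ → - 𝟙𝟎 (vertex b)) originIndex with kind (vertex a)
    added₁ a b () | origin
    added₁ a b _  | representative = lem x δ[ vertex a , vertex b ] (𝟙𝟎 (vertex b))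
      where
      lem : ∀ x d Z → (x - 1ℤ) * d ≡ ((x - 1ℤ) * d + Z) + - Z
      lem = solve-∀
    added₁ a b () | ordinary
    W₂ : Fin N → Fin N → Fin N → ℤ
    W₂ a t b = ⟦ t Fin.≟ lineIndex a ⟧ * δ[ normalize (vertex a) , vertex b ]
    kept₂ : ∀ a b → ordinaryVertex a ≡ false → matrix (diagonalRule x) a b ≡ matrix stage₄ a b
    kept₂ a b P-a with kind (vertex a)
    kept₂ a b _  | origin         = refl
    kept₂ a b _  | representative = refl
    kept₂ a b () | ordinary
    dependent₂ : ∀ a → ordinaryVertex a ≡ true → ∀ t → Dependent (λ k → ordinaryVertex k ≡ false) (matrix stage₄) (W₂ a t)
    dependent₂ a a-ord t with t Fin.≟ lineIndex a
    ... | yes refl = row-multiple-of (lineIndex a) (x - 1ℤ) (OrdinaryRow.lineIndex-not-ordinary a a-ord)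
                       (λ b → trans (matrix-row stage₄ (lineIndex a) (OrdinaryRow.lineIndex-representative a a-ord) b)
                                    (trans (cong (λ v → (x - 1ℤ) * δ[ v , vertex b ]) (vertex-lineIndex a))
                                           (cong ((x - 1ℤ) *_) (sym (ℤ.*-identityˡ δ[ normalize (vertex a) , vertex b ])))))
    ... | no  _    = zero-vector (λ b → ℤ.*-zeroˡ δ[ normalize (vertex a) , vertex b ])
    added₂ : ∀ a b → ordinaryVertex a ≡ true → matrix (diagonalRule x) a b ≡ matrix stage₄ a b + Σ (λ t → W₂ a t b)
    added₂ a b P-a rewrite Σ-delta (λ _ → δ[ normalize (vertex a) , vertex b ]) (lineIndex a) with kind (vertex a)
    added₂ a b () | origin
    added₂ a b () | representative
    added₂ a b _  | ordinary = lem δ[ vertex a , vertex b ] δ[ normalize (vertex a) , vertex b ]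
      where
      lem : ∀ d r → d ≡ (d - r) + r
      lem = solve-∀

  det-diagonalRule-value : ∀ x → det (matrix (diagonalRule x)) ≡ (x * (x - + N)) * (x - 1ℤ) ^ count representativeVertex
  det-diagonalRule-value x = begin
    det (matrix (diagonalRule x))
      ≡⟨ det-diagonal (matrix (diagonalRule x)) off-diagonal ⟩
    Π (λ a → matrix (diagonalRule x) a a)
      ≡⟨ Π-cong (λ a → on-diagonal a) ⟩
    Π (λ a → (if originVertex a then x * (x - + N) else 1ℤ) * (if representativeVertex a then x - 1ℤ else 1ℤ))
      ≡⟨ Π-distrib-* (λ a → if originVertex a then x * (x - + N) else 1ℤ) (λ a → if representativeVertex a then x - 1ℤ else 1ℤ) ⟩
    Π (λ a → if originVertex a then x * (x - + N) else 1ℤ) * Π (λ a → if representativeVertex a then x - 1ℤ else 1ℤ)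
      ≡⟨ cong₂ _*_ (trans (Π-count originVertex (x * (x - + N))) (trans (cong ((x * (x - + N)) ^_) count-originVertex) (ℤ.*-identityʳ (x * (x - + N)))))
                   (Π-count representativeVertex (x - 1ℤ)) ⟩
    (x * (x - + N)) * (x - 1ℤ) ^ count representativeVertex ∎
    where
    open ≡-Reasoning
    off-diagonal : ∀ a b → a ≢ b → matrix (diagonalRule x) a b ≡ 0ℤ
    off-diagonal a b a≢b with kind (vertex a) | kind-spec (vertex a)
    ... | origin         | origin a≡0 = trans (cong ((x * (x - + N)) *_)
                                                    (⟦⟧-no (vertex b ≟ᵛ 𝟎) (λ b≡0 → a≢b (vertex-injective (trans a≡0 (sym b≡0))))))
                                              (ℤ.*-zeroʳ (x * (x - + N)))
    ... | representative | _          = trans (cong ((x - 1ℤ) *_) (⟦⟧-no (vertex a ≟ᵛ vertex b) (a≢b ∘ vertex-injective))) (ℤ.*-zeroʳ (x - 1ℤ))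
    ... | ordinary       | _          = ⟦⟧-no (vertex a ≟ᵛ vertex b) (a≢b ∘ vertex-injective)
    on-diagonal : ∀ a → matrix (diagonalRule x) a a ≡ (if originVertex a then x * (x - + N) else 1ℤ) * (if representativeVertex a then x - 1ℤ else 1ℤ)
    on-diagonal a with kind (vertex a) | kind-spec (vertex a)
    ... | origin         | origin a≡0 = cong ((x * (x - + N)) *_) (⟦⟧-yes (vertex a ≟ᵛ 𝟎) a≡0)
    ... | representative | _          = trans (cong ((x - 1ℤ) *_) (⟦⟧-yes (vertex a ≟ᵛ vertex a) refl)) (ℤ.*-comm (x - 1ℤ) 1ℤ)
    ... | ordinary       | _          = ⟦⟧-yes (vertex a ≟ᵛ vertex a) refl

  det-stage₂-times-x-1 : ∀ x → (x - 1ℤ) * det (matrix (stage₂ x)) ≡ (x * (x - + N)) * (x - 1ℤ) ^ count representativeVertex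
  det-stage₂-times-x-1 x = trans (sym (det-stage₃ x)) (trans (sym (det-diagonalRule x)) (det-diagonalRule-value x))

-- The value at x = 1

module ValueAtOne (F : FiniteField) (n : ℕ) {N : ℕ} (e : Fin N ↔ V F n)
             (A : Matrix N) (A-adjacency : IsAdjacencyMatrix F n e A) where
  open FiniteField F using (q)
  open FieldTheory F
  open LinearDependenceGraph F n e
  open Reduction F n e A A-adjacency

  -- At x = 1 all representative rows of stage₂ equal 𝟙𝟎.
  det-stage₂-two-lines : ∀ {ρ σ} → IsRepresentative ρ → IsRepresentative σ → ρ ≢ σ → det (matrix (stage₂ 1ℤ)) ≡ 0ℤ
  det-stage₂-two-lines {ρ} {σ} ρ-rep σ-rep ρ≢σ =
    det-alternating N (matrix (stage₂ 1ℤ)) (index ρ) (index σ) (λ eq → ρ≢σ (trans (sym (vertex-index ρ)) (trans (cong vertex eq) (vertex-index σ))))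
      (λ b → trans (row-of ρ ρ-rep b) (sym (row-of σ σ-rep b)))
    where
    row-of : ∀ τ → IsRepresentative τ → ∀ b → matrix (stage₂ 1ℤ) (index τ) b ≡ 𝟙𝟎 (vertex b)
    row-of τ τ-rep b = trans (matrix-row (stage₂ 1ℤ) (index τ) (trans (cong kind (vertex-index τ)) (kind-representative τ-rep)) b)
                             (trans (cong (_+ 𝟙𝟎 (vertex b)) (ℤ.*-zeroˡ δ[ vertex (index τ) , vertex b ])) (ℤ.+-identityˡ _))

  module SingleLine (ρ : V F n) (ρ-rep : IsRepresentative ρ) (on-ρ : ∀ u → u ≢ 𝟎 → normalize u ≡ ρ) where
    ρIndex : Fin N
    ρIndex = index ρ

    ρ-kind : kind (vertex ρIndex) ≡ representative
    ρ-kind = trans (cong kind (vertex-index ρ)) (kind-representative ρ-rep)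

    ρIndex≢origin : ρIndex ≢ originIndex
    ρIndex≢origin eq = proj₁ ρ-rep (trans (sym (vertex-index ρ)) (trans (cong vertex eq) (vertex-index 𝟎)))

    representative≡ρ : ∀ {u} → IsRepresentative u → u ≡ ρ
    representative≡ρ (u≢0 , nu≡u) = trans (sym nu≡u) (on-ρ _ u≢0)

    𝟙rep≡δρ : ∀ w → 𝟙rep w ≡ δ[ ρ , w ]
    𝟙rep≡δρ w = ⟦⟧-cong (sym ∘ representative≡ρ) (λ ρ≡w → subst IsRepresentative ρ≡w ρ-rep) (representative? w) (ρ ≟ᵛ w)

    count-one-line : count representativeVertex ≡ 1
    count-one-line = ℤ.+-injective (begin
      + count representativeVertex                          ≡⟨ sym (Σ-count representativeVertex) ⟩
      Σ (λ k → if representativeVertex k then 1ℤ else 0ℤ)   ≡⟨ sym (Σ-cong (⟦representative⟧ ∘ vertex)) ⟩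
      Σ (λ k → 𝟙rep (vertex k))
        ≡⟨ Σ-cong (λ k → trans (𝟙rep≡δρ (vertex k)) (⟦⟧-sym (ρ ≟ᵛ vertex k) (vertex k ≟ᵛ ρ))) ⟩
      Σ (λ k → δ[ vertex k , ρ ])                        ≡⟨ Σ-vertex-unique ρ ⟩
      1ℤ                                                 ∎)
      where open ≡-Reasoning

    -- Make the origin row (q - 1) e_ρ, use it to turn each ordinary row into eᵤ, and swap it with row ρ (= e₀).
    det-stage₂-at-1 : det (matrix (stage₂ 1ℤ)) ≡ - (+ q - 1ℤ)
    det-stage₂-at-1 = begin
      det (matrix (stage₂ 1ℤ))   ≡⟨ sym origin-cleared ⟩
      det (matrix cleared)       ≡⟨ sym ordinary-cleared ⟩
      det (matrix unit-rows)     ≡⟨ sym (ℤ.neg-involutive _) ⟩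
      - - det (matrix unit-rows) ≡⟨ cong -_ (sym swapped) ⟩
      - det (matrix diagonalised) ≡⟨ cong -_ diagonal-value ⟩
      - (+ q - 1ℤ)               ∎
      where
      open ≡-Reasoning
      cleared unit-rows diagonalised : RowRule
      cleared origin         u w = (+ q - 1ℤ) * δ[ ρ , w ]
      cleared k              u w = stage₂ 1ℤ k u w
      unit-rows ordinary     u w = δ[ u , w ]
      unit-rows k            u w = cleared k u w
      diagonalised origin         u w = 𝟙𝟎 w
      diagonalised representative u w = (+ q - 1ℤ) * δ[ ρ , w ]
      diagonalised ordinary       u w = δ[ u , w ]

      origin-cleared : det (matrix cleared) ≡ det (matrix (stage₂ 1ℤ))
      origin-cleared = det-add-dependent (matrix (stage₂ 1ℤ)) (matrix cleared) originIndex
        (λ b → (+ N - + 2) * matrix (stage₂ 1ℤ) ρIndex b) (multiple-of-row ρIndex (+ N - + 2) ρIndex≢origin (λ b → refl))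
        (agree-off-origin cleared (stage₂ 1ℤ) (λ _ _ → refl) (λ _ _ → refl)) origin-row
        where
        origin-row : ∀ b → matrix cleared originIndex b ≡ matrix (stage₂ 1ℤ) originIndex b + (+ N - + 2) * matrix (stage₂ 1ℤ) ρIndex b
        origin-row b = begin
          matrix cleared originIndex b
            ≡⟨ matrix-row cleared originIndex origin-kind b ⟩
          (+ q - 1ℤ) * δ[ ρ , w ]
            ≡⟨ lem (+ N) (+ q) δ[ ρ , w ] (𝟙𝟎 w) δ[ vertex ρIndex , w ] ⟩
          ((1ℤ - + N + 1ℤ) * 𝟙𝟎 w + (+ q - 1ℤ) * δ[ ρ , w ]) + (+ N - + 2) * ((1ℤ - 1ℤ) * δ[ vertex ρIndex , w ] + 𝟙𝟎 w)
            ≡⟨ sym (cong₂ (λ s t → ((1ℤ - + N + 1ℤ) * 𝟙𝟎 w + (+ q - 1ℤ) * s) + (+ N - + 2) * t)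
                          (𝟙rep≡δρ w) (matrix-row (stage₂ 1ℤ) ρIndex ρ-kind b)) ⟩
          stage₂ 1ℤ origin (vertex originIndex) w + (+ N - + 2) * matrix (stage₂ 1ℤ) ρIndex b
            ≡⟨ sym (cong (_+ (+ N - + 2) * matrix (stage₂ 1ℤ) ρIndex b) (matrix-row (stage₂ 1ℤ) originIndex origin-kind b)) ⟩
          matrix (stage₂ 1ℤ) originIndex b + (+ N - + 2) * matrix (stage₂ 1ℤ) ρIndex b ∎
          where
          w = vertex b
          lem : ∀ N q e Z d → (q - 1ℤ) * e ≡ ((1ℤ - N + 1ℤ) * Z + (q - 1ℤ) * e) + (N - + 2) * ((1ℤ - 1ℤ) * d + Z)
          lem = solve-∀

      ordinary-cleared : det (matrix unit-rows) ≡ det (matrix cleared)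
      ordinary-cleared = det-rowwise-add ordinaryVertex (matrix cleared) (matrix unit-rows) W kept dependent added
        where
        W : Fin N → Fin N → Fin N → ℤ
        W a t b = ⟦ t Fin.≟ originIndex ⟧ * δ[ ρ , vertex b ]
        kept : ∀ a b → ordinaryVertex a ≡ false → matrix unit-rows a b ≡ matrix cleared a b
        kept a b P-a with kind (vertex a)
        kept a b _  | origin         = refl
        kept a b _  | representative = refl
        kept a b () | ordinary
        dependent : ∀ a → ordinaryVertex a ≡ true → ∀ t → Dependent (λ k → ordinaryVertex k ≡ false) (matrix cleared) (W a t)
        dependent a _ t with t Fin.≟ originIndex
        ... | yes refl = row-multiple-of originIndex (+ q - 1ℤ) (cong isOrdinary origin-kind)
                           (λ b → trans (matrix-row cleared originIndex origin-kind b) (cong ((+ q - 1ℤ) *_) (sym (ℤ.*-identityˡ _))))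
        ... | no  _    = zero-vector (λ b → ℤ.*-zeroˡ δ[ ρ , vertex b ])
        added : ∀ a b → ordinaryVertex a ≡ true → matrix unit-rows a b ≡ matrix cleared a b + Σ (λ t → W a t b)
        added a b a-ord = begin
          matrix unit-rows a b
            ≡⟨ matrix-row unit-rows a a-kind b ⟩
          δ[ vertex a , vertex b ]
            ≡⟨ lem δ[ vertex a , vertex b ] δ[ ρ , vertex b ] ⟩
          (δ[ vertex a , vertex b ] - δ[ ρ , vertex b ]) + δ[ ρ , vertex b ]
            ≡⟨ sym (cong₂ (λ v s → (δ[ vertex a , vertex b ] - δ[ v , vertex b ]) + s)
                          (on-ρ (vertex a) (OrdinaryRow.vertex≢𝟎 a a-ord)) (Σ-delta (λ _ → δ[ ρ , vertex b ]) originIndex)) ⟩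
          stage₂ 1ℤ ordinary (vertex a) (vertex b) + Σ (λ t → W a t b)
            ≡⟨ sym (cong (_+ Σ (λ t → W a t b)) (matrix-row cleared a a-kind b)) ⟩
          matrix cleared a b + Σ (λ t → W a t b) ∎
          where
          a-kind : kind (vertex a) ≡ ordinary
          a-kind = isOrdinary-true a-ord
          lem : ∀ d r → d ≡ (d - r) + r
          lem = solve-∀

      swapped : det (matrix diagonalised) ≡ - det (matrix unit-rows)
      swapped = det-swap (det-alternating N) (matrix unit-rows) (matrix diagonalised) originIndex ρIndex (ρIndex≢origin ∘ sym)
                  (λ b → trans (matrix-row diagonalised originIndex origin-kind b)
                               (sym (trans (matrix-row unit-rows ρIndex ρ-kind b)
                                           (trans (cong (_+ 𝟙𝟎 (vertex b)) (ℤ.*-zeroˡ δ[ vertex ρIndex , vertex b ]))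
                                                  (ℤ.+-identityˡ (𝟙𝟎 (vertex b)))))))
                  (λ b → trans (matrix-row diagonalised ρIndex ρ-kind b) (sym (matrix-row unit-rows originIndex origin-kind b)))
                  elsewhere
        where
        elsewhere : ∀ a b → a ≢ originIndex → a ≢ ρIndex → matrix diagonalised a b ≡ matrix unit-rows a b
        elsewhere a b a≢o a≢ρ with kind (vertex a) | kind-spec (vertex a)
        ... | origin         | spec = ⊥-elim (not-origin a a≢o spec refl)
        ... | representative | representative a-rep =
          ⊥-elim (a≢ρ (trans (sym (index-vertex a)) (cong index (representative≡ρ a-rep))))
        ... | ordinary       | _ = refl

      diagonal-value : det (matrix diagonalised) ≡ + q - 1ℤ
      diagonal-value = begin
        det (matrix diagonalised)                                   ≡⟨ det-diagonal (matrix diagonalised) off-diagonal ⟩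
        Π (λ a → matrix diagonalised a a)                           ≡⟨ Π-cong on-diagonal ⟩
        Π (λ a → if representativeVertex a then + q - 1ℤ else 1ℤ)      ≡⟨ Π-count representativeVertex (+ q - 1ℤ) ⟩
        (+ q - 1ℤ) ^ count representativeVertex                        ≡⟨ cong ((+ q - 1ℤ) ^_) count-one-line ⟩
        (+ q - 1ℤ) ^ 1                                              ≡⟨ ℤ.*-identityʳ (+ q - 1ℤ) ⟩
        + q - 1ℤ                                                    ∎
        where
        off-diagonal : ∀ a b → a ≢ b → matrix diagonalised a b ≡ 0ℤ
        off-diagonal a b a≢b with kind (vertex a) | kind-spec (vertex a)
        ... | origin         | origin a≡0 = ⟦⟧-no (vertex b ≟ᵛ 𝟎) (λ b≡0 → a≢b (vertex-injective (trans a≡0 (sym b≡0))))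
        ... | representative | representative a-rep =
          trans (cong ((+ q - 1ℤ) *_) (⟦⟧-no (ρ ≟ᵛ vertex b) (λ ρ≡b → a≢b (vertex-injective (trans (representative≡ρ a-rep) ρ≡b)))))
                (ℤ.*-zeroʳ (+ q - 1ℤ))
        ... | ordinary       | _ = ⟦⟧-no (vertex a ≟ᵛ vertex b) (a≢b ∘ vertex-injective)
        on-diagonal : ∀ a → matrix diagonalised a a ≡ (if representativeVertex a then + q - 1ℤ else 1ℤ)
        on-diagonal a with kind (vertex a) | kind-spec (vertex a)
        ... | origin         | origin a≡0 = ⟦⟧-yes (vertex a ≟ᵛ 𝟎) a≡0
        ... | representative | representative a-rep =
          trans (cong ((+ q - 1ℤ) *_) (⟦⟧-yes (ρ ≟ᵛ vertex a) (sym (representative≡ρ a-rep)))) (ℤ.*-identityʳ (+ q - 1ℤ))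
        ... | ordinary       | _ = ⟦⟧-yes (vertex a ≟ᵛ vertex a) refl

powSum-geometric : ∀ q k → (+ q - 1ℤ) * (+ powSum q k + 1ℤ) ≡ + (q ^ℕ suc k) - 1ℤ
powSum-geometric q zero    = trans (lem (+ q)) (cong (_- 1ℤ) (sym (ℤ.pos-* q 1)))
  where
  lem : ∀ q → (q - 1ℤ) * (0ℤ + 1ℤ) ≡ q * 1ℤ - 1ℤ
  lem = solve-∀
powSum-geometric q (suc k) = begin
  (+ q - 1ℤ) * (+ (P +ℕ Q) + 1ℤ)              ≡⟨ cong (λ t → (+ q - 1ℤ) * (t + 1ℤ)) (ℤ.pos-+ P Q) ⟩
  (+ q - 1ℤ) * (+ P + + Q + 1ℤ)               ≡⟨ lem₁ (+ q) (+ P) (+ Q) ⟩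
  (+ q - 1ℤ) * (+ P + 1ℤ) + (+ q - 1ℤ) * + Q  ≡⟨ cong (_+ (+ q - 1ℤ) * + Q) (powSum-geometric q k) ⟩
  (+ Q - 1ℤ) + (+ q - 1ℤ) * + Q               ≡⟨ lem₂ (+ q) (+ Q) ⟩
  + q * + Q - 1ℤ                              ≡⟨ cong (_- 1ℤ) (sym (ℤ.pos-* q Q)) ⟩
  + (q *ℕ Q) - 1ℤ                             ∎
  where
  open ≡-Reasoning
  P = powSum q k
  Q = q ^ℕ suc k
  lem₁ : ∀ q P Q → (q - 1ℤ) * (P + Q + 1ℤ) ≡ (q - 1ℤ) * (P + 1ℤ) + (q - 1ℤ) * Q
  lem₁ = solve-∀
  lem₂ : ∀ q Q → (Q - 1ℤ) + (q - 1ℤ) * Q ≡ q * Q - 1ℤ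
  lem₂ = solve-∀

0^-nonzero : ∀ m → m ≢ 0 → (1ℤ - 1ℤ) ^ m ≡ 0ℤ
0^-nonzero zero    m≢0 = ⊥-elim (m≢0 refl)
0^-nonzero (suc m) _   = refl

det-stage₂-at-one : ∀ (F : FiniteField) n → 1 ≤ n → ∀ {N} (e : Fin N ↔ V F n) (A : Matrix N) (A-adjacency : IsAdjacencyMatrix F n e A) →
                    let open Reduction F n e A A-adjacency in
                    det (matrix (stage₂ 1ℤ)) ≡ 1ℤ * (1ℤ - + N) * (1ℤ - 1ℤ) ^ powSum (FiniteField.q F) (n ∸ 1)
det-stage₂-at-one F (suc zero) _ {N} e A A-adjacency = begin
  det (matrix (stage₂ 1ℤ))       ≡⟨ SingleLine.det-stage₂-at-1 (1# ∷ []) representative-1∷𝟎 normalize-F¹ ⟩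
  - (+ q - 1ℤ)                   ≡⟨ cong (λ t → - (+ t - 1ℤ)) (trans (sym (ℕ.*-identityʳ q)) (sym (|V|≡q^n 1 N e))) ⟩
  - (+ N - 1ℤ)                   ≡⟨ lem (+ N) ⟩
  1ℤ * (1ℤ - + N) * 1ℤ           ∎
  where
  open ≡-Reasoning
  open FiniteField F using (q; 1#)
  open FieldTheory F
  open Reduction F 1 e A A-adjacency
  open ValueAtOne F 1 e A A-adjacency
  lem : ∀ N → - (N - 1ℤ) ≡ 1ℤ * (1ℤ - N) * 1ℤ
  lem = solve-∀
det-stage₂-at-one F (suc (suc k)) _ {N} e A A-adjacency = begin
  det (matrix (stage₂ 1ℤ))                        ≡⟨ det-stage₂-two-lines e₁ e₂ e₁≢e₂ ⟩
  0ℤ                                              ≡⟨ sym (ℤ.*-zeroʳ (1ℤ * (1ℤ - + N))) ⟩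
  1ℤ * (1ℤ - + N) * 0ℤ                            ≡⟨ cong (1ℤ * (1ℤ - + N) *_) (sym (0^-nonzero (powSum q (suc k)) P≢0)) ⟩
  1ℤ * (1ℤ - + N) * (1ℤ - 1ℤ) ^ powSum q (suc k) ∎
  where
  open ≡-Reasoning
  open FiniteField F using (q; 0#; 1#)
  open FieldTheory F
  open Reduction F (suc (suc k)) e A A-adjacency
  open ValueAtOne F (suc (suc k)) e A A-adjacency
  e₁ : IsRepresentative (1# ∷ 𝟎 {suc k})
  e₁ = representative-1∷𝟎
  e₂ : IsRepresentative (0# ∷ 1# ∷ 𝟎 {k})
  e₂ = representative-0∷ representative-1∷𝟎
  e₁≢e₂ : 1# ∷ 𝟎 {suc k} ≢ 0# ∷ 1# ∷ 𝟎 {k}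
  e₁≢e₂ eq = 1≢0 (Vec.∷-injectiveˡ eq)
  P≢0 : powSum q (suc k) ≢ 0
  P≢0 = ℕ.>⇒≢ (ℕ.<-≤-trans (ℕ.m^n>0 q {{≢-nonZero q≢0}} (suc k)) (ℕ.m≤n+m (q ^ℕ suc k) (powSum q k)))
    where
    q≢0 : q ≢ 0
    q≢0 q≡0 with q≥2
    ... | r , q≡r+2 = ℕ.0≢1+n (trans (sym q≡0) q≡r+2)

module CharacteristicDeterminant (F : FiniteField) (n : ℕ) {N : ℕ} (e : Fin N ↔ V F n)
                (A : Matrix N) (A-adjacency : IsAdjacencyMatrix F n e A) where
  open FiniteField F using (q)
  open FieldTheory F
  open LinearDependenceGraph F n e
  open Reduction F n e A A-adjacency
  open ValueAtOne F n e A A-adjacency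

  P : ℕ
  P = powSum q (n ∸ 1)

  r : ℕ
  r = proj₁ q≥2

  q≡r+2 : q ≡ suc (suc r)
  q≡r+2 = proj₂ q≥2

  N-1≡ : 1 ≤ n → + N - 1ℤ ≡ (+ q - 1ℤ) * (+ P + 1ℤ)
  N-1≡ 1≤n = trans (cong (λ t → + t - 1ℤ) (trans (|V|≡q^n n N e) (cong (q ^ℕ_) (sym suc-pred))))
                   (sym (powSum-geometric q (n ∸ 1)))
    where
    suc-pred : suc (n ∸ 1) ≡ n
    suc-pred = trans (ℕ.+-comm 1 (n ∸ 1)) (ℕ.m∸n+n≡m 1≤n)

  count-representatives : 1 ≤ n → count representativeVertex ≡ P +ℕ 1
  count-representatives 1≤n = ℤ.+-injective (ℤ.*-cancelʳ-≡ _ _ (+ q - 1ℤ) {{q-1≢0}} (begin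
    + count representativeVertex * (+ q - 1ℤ)   ≡⟨ count-lines ⟩
    + N - 1ℤ                                    ≡⟨ N-1≡ 1≤n ⟩
    (+ q - 1ℤ) * (+ P + 1ℤ)                     ≡⟨ ℤ.*-comm (+ q - 1ℤ) (+ P + 1ℤ) ⟩
    (+ P + 1ℤ) * (+ q - 1ℤ)                     ≡⟨ cong (_* (+ q - 1ℤ)) (sym (ℤ.pos-+ P 1)) ⟩
    + (P +ℕ 1) * (+ q - 1ℤ)                     ∎))
    where
    open ≡-Reasoning
    q-1≢0 : ℤ.NonZero (+ q - 1ℤ)
    q-1≢0 rewrite q≡r+2 = _

  count-ordinaries : 1 ≤ n → count ordinaryVertex ≡ (q ∸ 2) *ℕ (P +ℕ 1)
  count-ordinaries 1≤n = ℤ.+-injective (begin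
    + count ordinaryVertex
      ≡⟨ lem (+ count representativeVertex) (+ count ordinaryVertex) ⟩
    (+ count representativeVertex + + count ordinaryVertex) - + count representativeVertex
      ≡⟨ cong₂ _-_ (sym count-nonzero-split) (cong +_ (count-representatives 1≤n)) ⟩
    (+ N - 1ℤ) - + (P +ℕ 1)
      ≡⟨ cong₂ _-_ (N-1≡ 1≤n) (ℤ.pos-+ P 1) ⟩
    (+ q - 1ℤ) * (+ P + 1ℤ) - (+ P + 1ℤ)
      ≡⟨ cong (λ t → (+ t - 1ℤ) * (+ P + 1ℤ) - (+ P + 1ℤ)) q≡r+2 ⟩
    (+ suc (suc r) - 1ℤ) * (+ P + 1ℤ) - (+ P + 1ℤ)
      ≡⟨ lem′ (+ r) (+ P) ⟩
    + r * (+ P + 1ℤ)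
      ≡⟨ cong₂ _*_ (cong +_ (sym (cong (_∸ 2) q≡r+2))) (sym (ℤ.pos-+ P 1)) ⟩
    + (q ∸ 2) * + (P +ℕ 1)
      ≡⟨ sym (ℤ.pos-* (q ∸ 2) (P +ℕ 1)) ⟩
    + ((q ∸ 2) *ℕ (P +ℕ 1)) ∎)
    where
    open ≡-Reasoning
    lem : ∀ R O → O ≡ (R + O) - R
    lem = solve-∀
    lem′ : ∀ r P → (1ℤ + (1ℤ + r) - 1ℤ) * (P + 1ℤ) - (P + 1ℤ) ≡ r * (P + 1ℤ)
    lem′ = solve-∀

  det-stage₂-value : 1 ≤ n → ∀ x → det (matrix (stage₂ x)) ≡ x * (x - + N) * (x - 1ℤ) ^ P
  det-stage₂-value 1≤n x with x ℤ.≟ 1ℤ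
  ... | yes refl = det-stage₂-at-one F n 1≤n e A A-adjacency
  ... | no  x≢1  = ℤ.*-cancelˡ-≡ (x - 1ℤ) _ _ {{ℤ.≢-nonZero x-1≢0}} (begin
    (x - 1ℤ) * det (matrix (stage₂ x))
      ≡⟨ det-stage₂-times-x-1 x ⟩
    (x * (x - + N)) * (x - 1ℤ) ^ count representativeVertex
      ≡⟨ cong ((x * (x - + N)) *_) (cong ((x - 1ℤ) ^_) (trans (count-representatives 1≤n) (ℕ.+-comm P 1))) ⟩
    (x * (x - + N)) * ((x - 1ℤ) * (x - 1ℤ) ^ P)
      ≡⟨ lem (x * (x - + N)) (x - 1ℤ) ((x - 1ℤ) ^ P) ⟩
    (x - 1ℤ) * (x * (x - + N) * (x - 1ℤ) ^ P) ∎)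
    where
    open ≡-Reasoning
    x-1≢0 : x - 1ℤ ≢ 0ℤ
    x-1≢0 eq = x≢1 (trans (shift x) (cong (_+ 1ℤ) eq))
      where
      shift : ∀ x → x ≡ (x - 1ℤ) + 1ℤ
      shift = solve-∀
    lem : ∀ X a b → X * (a * b) ≡ a * (X * b)
    lem = solve-∀

  det-charMatrix-value : 1 ≤ n → ∀ x → det (charMatrix x (laplacian A))
                         ≡ x * (x - + (q ^ℕ n)) * ((x - + 1) ^ P) * ((x - + q) ^ ((q ∸ 2) *ℕ (P +ℕ 1)))
  det-charMatrix-value 1≤n x = begin
    det (charMatrix x (laplacian A))
      ≡⟨ det-charMatrix-stage₁ x ⟩
    (x - + q) ^ count ordinaryVertex * det (matrix (stage₁ x))
      ≡⟨ cong₂ _*_ (cong ((x - + q) ^_) (count-ordinaries 1≤n)) (trans (sym (det-stage₂ x)) (det-stage₂-value 1≤n x)) ⟩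
    (x - + q) ^ m * (x * (x - + N) * (x - 1ℤ) ^ P)
      ≡⟨ ℤ.*-comm ((x - + q) ^ m) (x * (x - + N) * (x - 1ℤ) ^ P) ⟩
    x * (x - + N) * (x - 1ℤ) ^ P * (x - + q) ^ m
      ≡⟨ cong (λ t → x * (x - + t) * (x - 1ℤ) ^ P * (x - + q) ^ m) (|V|≡q^n n N e) ⟩
    x * (x - + (q ^ℕ n)) * ((x - + 1) ^ P) * ((x - + q) ^ m) ∎
    where
    open ≡-Reasoning
    m = (q ∸ 2) *ℕ (P +ℕ 1)

mainTheorem12 : (F : FiniteField) (n : ℕ) → 1 ≤ n →
    (N : ℕ) (e : Fin N ↔ V F n) (A : Matrix N) → IsAdjacencyMatrix F n e A →
    (x : ℤ) →
    det (charMatrix x (laplacian A))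
      ≡ x * (x - + (FiniteField.q F ^ℕ n))
          * ((x - + 1) ^ powSum (FiniteField.q F) (n ∸ 1))
          * ((x - + FiniteField.q F) ^ ((FiniteField.q F ∸ 2) *ℕ (powSum (FiniteField.q F) (n ∸ 1) +ℕ 1)))
mainTheorem12 F n 1≤n N e A A-adjacency = CharacteristicDeterminant.det-charMatrix-value F n e A A-adjacency 1≤n
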